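{- Let $k \geq 6$ be an integer and let $G$ be a graph on a vertex set $V$ belonging to one of the five classes $\mathcal{G}_1, \ldots, \mathcal{G}_5$ defined below, with corresponding sets $V_1, V_2$ (and $x_0$ where applicable). Let $\mathcal{A} \subseteq E(G)$ be a set of edges with $|\mathcal{A}| \leq 1$ if $G \in \mathcal{G}_2 \cup \mathcal{G}_3 \cup \mathcal{G}_4$, and with $|\mathcal{A}| \leq 2$ if $G \in \mathcal{G}_1 \cup \mathcal{G}_5$. Let $\mathcal{B}$ be a set of new pairs as follows: (i) if $G \in \mathcal{G}_1$, $\mathcal{B}$ consists of two disjoint pairs, each joining a vertex of $V_1$ to a vertex of $V_2$; (ii) if $G \in \mathcal{G}_2 \cup \mathcal{G}_3$, $\mathcal{B} = \{x_1x_2\}$ for some $x_1 \in V_1 \setminus \{x_0\}$ and $x_2 \in V_2 \setminus \{x_0\}$; (iii) if $G \in \mathcal{G}_4$, $\mathcal{B}$ consists of one pair contained in $V_2$; (iv) if $G \in \mathcal{G}_5$, $\mathcal{B}$ consists of two distinct pairs contained in $V_2$. Then the graph on $V$ with edge set $(E(G) \setminus \mathcal{A}) \cup \mathcal{B}$ is hamiltonian, except in the following case: $G \in \mathcal{G}_3$, $x_0$ has exactly two neighbors $x_2$ and $y_2$ in $V_2$, $\mathcal{A} = \{x_0y_2\}$, $\mathcal{B} = \{x_1x_2\}$ (with $x_1 \in V_1 \setminus \{x_0\}$), and $G[V_2 \setminus \{x_0\}]$ is either a complete graph $K_{k+1}$ or a complete graph missing only the edge $x_2y_2$.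
   Context: All graphs are simple. The five classes of graphs on a vertex set $V$ (depending on the integer $k$) are: $\mathcal{G}_1$: $|V| = 2k+2$, $V = V_1 \cup V_2$ with $V_1 \cap V_2 = \emptyset$ and $|V_1| = |V_2| = k+1$; the edge set of $G$ is the union of the edge sets of the complete graphs on $V_1$ and on $V_2$, together with at most one further edge $e_0$ joining $V_1$ and $V_2$. $\mathcal{G}_2$: $|V| = 2k+1$, $V = V_1 \cup V_2$ with $|V_1| = |V_2| = k+1$ and $V_1 \cap V_2 = \{x_0\}$; the edge set of $G$ is the union of the edge sets of the complete graphs on $V_1$ and on $V_2$. $\mathcal{G}_3$: $|V| = 2k+2$, $V = V_1 \cup V_2$ with $|V_1| = k+1$, $|V_2| = k+2$ and $V_1 \cap V_2 = \{x_0\}$; the edge set of $G$ is the union of the edge set of the complete graph on $V_1$ and the edge set of a 2-connected graph $G_2$ with vertex set $V_2$, and $\deg_G(v) \geq k$ for every $v \in V$. $\mathcal{G}_4$: $|V| = 2k+1$, $V = V_1 \cup V_2$ with $V_1 \cap V_2 = \emptyset$, $|V_1| = k$, $|V_2| = k+1$; $V_2$ is an independent set in $G$ and $G$ contains all edges joining $V_1$ and $V_2$. $\mathcal{G}_5$: $|V| = 2k+2$, $V = V_1 \cup V_2$ with $V_1 \cap V_2 = \emptyset$, $|V_1| = k$, $|V_2| = k+2$; $V_2$ spans at most one edge $e_0$ of $G$, and $\deg_G(v) \geq k$ for every $v \in V$. A graph is hamiltonian if it has a cycle through all of its vertices. $G[U]$ denotes the subgraph induced by $U$. -}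

module Defs where

open import Data.Nat using (ℕ; zero; suc; _+_; _*_; _≤_; _<?_)
open import Data.Bool using (Bool; true; false)
open import Data.Fin using (Fin; toℕ; fromℕ<) renaming (zero to fzero)
open import Data.Fin.Subset using (Subset; _∈_; _∉_; ∣_∣; _-_)
open import Data.Vec using (tabulate)
open import Data.List using (List; []; _∷_; length)
open import Data.List.Relation.Unary.Any using (Any)
open import Data.Product using (Σ; ∃; _×_; _,_; proj₁; proj₂)
open import Data.Sum using (_⊎_)
open import Relation.Binary.PropositionalEquality using (_≡_; _≢_)
open import Relation.Nullary using (¬_; yes; no)
open import Function.Definitions using (Bijective)
open import Function.Bundles using (_⇔_)

record Graph (n : ℕ) : Set where
  field
    adj    : Fin n → Fin n → Bool
    sym    : ∀ u v → adj u v ≡ adj v u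
    irrefl : ∀ v → adj v v ≡ false

module _ {n : ℕ} (G : Graph n) where
  open Graph G

  Edge : Fin n → Fin n → Set
  Edge u v = adj u v ≡ true

  deg : Fin n → ℕ
  deg v = ∣ tabulate (adj v) ∣

  data WalkIn (S : Subset n) : Fin n → Fin n → Set where
    here : ∀ {u} → WalkIn S u u
    step : ∀ {u v w} → v ∈ S → Edge u v → WalkIn S v w → WalkIn S u w

  ConnectedOn : Subset n → Set
  ConnectedOn S = ∀ u v → u ∈ S → v ∈ S → WalkIn S u v

  TwoConnectedOn : Subset n → Set
  TwoConnectedOn S = (3 ≤ ∣ S ∣) × ConnectedOn S × (∀ w → w ∈ S → ConnectedOn (S - w))

next : ∀ {n} → Fin n → Fin n
next {suc m} i with suc (toℕ i) <? suc m
... | yes p = fromℕ< p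
... | no _  = fzero

Hamiltonian : ∀ {n} → (Fin n → Fin n → Set) → Set
Hamiltonian {n} R =
  (3 ≤ n) × Σ (Fin n → Fin n) λ f → Bijective _≡_ _≡_ f × (∀ i → R (f i) (f (next i)))

-- Sets of (unordered) pairs, represented by lists of ordered pairs.

SamePair : ∀ {n} → Fin n × Fin n → Fin n → Fin n → Set
SamePair (a , b) u v = (a ≡ u × b ≡ v) ⊎ (a ≡ v × b ≡ u)

PairIn : ∀ {n} → List (Fin n × Fin n) → Fin n → Fin n → Set
PairIn L u v = Any (λ p → SamePair p u v) L

Modified : ∀ {n} → Graph n → List (Fin n × Fin n) → List (Fin n × Fin n) → Fin n → Fin n → Set
Modified G A B u v = (Edge G u v × ¬ PairIn A u v) ⊎ PairIn B u v

module _ {n : ℕ} (k : ℕ) (G : Graph n) (V₁ V₂ : Subset n) where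

  Covers : Set
  Covers = ∀ v → v ∈ V₁ ⊎ v ∈ V₂

  Disjoint : Set
  Disjoint = ∀ v → v ∈ V₁ → v ∉ V₂

  MeetIn : Fin n → Set
  MeetIn x₀ = x₀ ∈ V₁ × x₀ ∈ V₂ × (∀ v → v ∈ V₁ → v ∈ V₂ → v ≡ x₀)

  CompleteOn : Subset n → Set
  CompleteOn S = ∀ u v → u ∈ S → v ∈ S → u ≢ v → Edge G u v

  MinDeg : Set
  MinDeg = ∀ v → k ≤ deg G v

  IsG1 : Set
  IsG1 = n ≡ 2 * k + 2 × Covers × Disjoint × ∣ V₁ ∣ ≡ k + 1 × ∣ V₂ ∣ ≡ k + 1
       × CompleteOn V₁ × CompleteOn V₂
       -- at most one edge between V₁ and V₂
       × (∀ a b c d → a ∈ V₁ → b ∈ V₂ → c ∈ V₁ → d ∈ V₂ → Edge G a b → Edge G c d → a ≡ c × b ≡ d)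

  IsG2 : Fin n → Set
  IsG2 x₀ = n ≡ 2 * k + 1 × Covers × MeetIn x₀ × ∣ V₁ ∣ ≡ k + 1 × ∣ V₂ ∣ ≡ k + 1
       × (∀ u v → Edge G u v ⇔ (u ≢ v × ((u ∈ V₁ × v ∈ V₁) ⊎ (u ∈ V₂ × v ∈ V₂))))

  -- E(G) = E(K_{V₁}) ∪ E(G₂) with G₂ a 2-connected graph on V₂;
  -- necessarily G₂ = G[V₂].
  IsG3 : Fin n → Set
  IsG3 x₀ = n ≡ 2 * k + 2 × Covers × MeetIn x₀ × ∣ V₁ ∣ ≡ k + 1 × ∣ V₂ ∣ ≡ k + 2
       × CompleteOn V₁
       × (∀ u v → Edge G u v → (u ∈ V₁ × v ∈ V₁) ⊎ (u ∈ V₂ × v ∈ V₂))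
       × TwoConnectedOn G V₂
       × MinDeg

  IsG4 : Set
  IsG4 = n ≡ 2 * k + 1 × Covers × Disjoint × ∣ V₁ ∣ ≡ k × ∣ V₂ ∣ ≡ k + 1
       × (∀ u v → u ∈ V₂ → v ∈ V₂ → ¬ Edge G u v)
       × (∀ u v → u ∈ V₁ → v ∈ V₂ → Edge G u v)

  IsG5 : Set
  IsG5 = n ≡ 2 * k + 2 × Covers × Disjoint × ∣ V₁ ∣ ≡ k × ∣ V₂ ∣ ≡ k + 2
       -- V₂ spans at most one edge
       × (∀ a b c d → a ∈ V₂ → b ∈ V₂ → c ∈ V₂ → d ∈ V₂ → Edge G a b → Edge G c d → SamePair (a , b) c d)
       × MinDeg

module _ {n : ℕ} where

  EdgesOf : Graph n → List (Fin n × Fin n) → Set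
  EdgesOf G [] = Data.Unit.⊤
    where import Data.Unit
  EdgesOf G ((a , b) ∷ L) = Edge G a b × EdgesOf G L

  NewPairs : Graph n → List (Fin n × Fin n) → Set
  NewPairs G [] = Data.Unit.⊤
    where import Data.Unit
  NewPairs G ((a , b) ∷ L) = (a ≢ b × ¬ Edge G a b) × NewPairs G L

  data Setting (k : ℕ) (G : Graph n) (V₁ V₂ : Subset n)
               (A B : List (Fin n × Fin n)) : Set where
    inG1 : IsG1 k G V₁ V₂ → length A ≤ 2
         → ∀ a₁ b₁ a₂ b₂ → B ≡ (a₁ , b₁) ∷ (a₂ , b₂) ∷ []
         → a₁ ∈ V₁ → b₁ ∈ V₂ → a₂ ∈ V₁ → b₂ ∈ V₂
         → a₁ ≢ a₂ → b₁ ≢ b₂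
         → Setting k G V₁ V₂ A B
    inG2 : ∀ x₀ → IsG2 k G V₁ V₂ x₀ → length A ≤ 1
         → ∀ x₁ x₂ → B ≡ (x₁ , x₂) ∷ []
         → x₁ ∈ V₁ → x₁ ≢ x₀ → x₂ ∈ V₂ → x₂ ≢ x₀
         → Setting k G V₁ V₂ A B
    inG3 : ∀ x₀ → IsG3 k G V₁ V₂ x₀ → length A ≤ 1
         → ∀ x₁ x₂ → B ≡ (x₁ , x₂) ∷ []
         → x₁ ∈ V₁ → x₁ ≢ x₀ → x₂ ∈ V₂ → x₂ ≢ x₀
         → Setting k G V₁ V₂ A B
    inG4 : IsG4 k G V₁ V₂ → length A ≤ 1
         → ∀ a b → B ≡ (a , b) ∷ []
         → a ∈ V₂ → b ∈ V₂
         → Setting k G V₁ V₂ A B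
    inG5 : IsG5 k G V₁ V₂ → length A ≤ 2
         → ∀ a b c d → B ≡ (a , b) ∷ (c , d) ∷ []
         → a ∈ V₂ → b ∈ V₂ → c ∈ V₂ → d ∈ V₂
         → ¬ SamePair (a , b) c d
         → Setting k G V₁ V₂ A B

  Exceptional : ℕ → Graph n → Subset n → Subset n → List (Fin n × Fin n) → List (Fin n × Fin n) → Set
  Exceptional k G V₁ V₂ A B =
    ∃ λ x₀ → ∃ λ x₁ → ∃ λ x₂ → ∃ λ y₂ →
      IsG3 k G V₁ V₂ x₀
      × x₁ ∈ V₁ × x₁ ≢ x₀ × x₂ ∈ V₂ × x₂ ≢ x₀ × y₂ ∈ V₂ × x₂ ≢ y₂
      × (∀ v → v ∈ V₂ → Edge G x₀ v ⇔ (v ≡ x₂ ⊎ v ≡ y₂))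
      × (∀ u v → PairIn A u v ⇔ SamePair (x₀ , y₂) u v)
      × (∀ u v → PairIn B u v ⇔ SamePair (x₁ , x₂) u v)
      -- G[V₂ ∖ {x₀}] is K_{k+1} or K_{k+1} minus the edge x₂y₂
      × (∀ u v → u ∈ V₂ - x₀ → v ∈ V₂ - x₀ → u ≢ v → ¬ SamePair (x₂ , y₂) u v → Edge G u v)

module Submission where

-- Every cycle is assembled from Hamiltonian paths obtained by one rotation argument: start from
-- any ordering of the required vertices and remove breaks (non-adjacent consecutive p , q) one at a
-- time by 2-opt moves, using a consecutive pair (a , b) with p ~ a and q ~ b. Counting
-- non-neighbours shows such a pair exists (i) in a part with at least 2d + 3 vertices each missing
-- at most d + 1 of them, and (ii) for paths alternating between V₁ and its complement when a
-- non-adjacent cross pair misses fewer than k = |V₁| vertices on the opposite sides.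
-- In G₁, G₂, G₃ the parts V₁ and V ∖ V₁ are nearly complete, so (i) gives paths inside them that
-- are closed up by the new pairs and, for G₂ and G₃, a surviving edge x₀y with y ∉ V₁. In G₄ and G₅
-- the minimum degree gives the bound of (ii) and the new pairs inside V₂ fix the two extra vertices
-- of the alternation. In G₃ a suitable y can only be missing when 2-connectivity and the degree
-- bound force exactly the exceptional configuration.

open import Defs
open import Data.Bool using (Bool; true; false; _∧_; _∨_; not; _xor_)
open import Data.Bool.ListAction using (any)
open import Data.Bool.Properties using (∨-comm; ∧-comm; ∧-assoc; ∧-identityʳ; ∧-zeroʳ; ∨-identityʳ; xor-comm; xor-same)
open import Data.Empty using (⊥; ⊥-elim)
open import Data.Fin using (Fin; toℕ; fromℕ<; _≟_) renaming (zero to fzero; suc to fsuc)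
open import Data.Fin.Properties using (toℕ-injective; toℕ<n; toℕ-fromℕ<)
open import Data.Fin.Subset using (Subset; _∈_; _∉_; ∣_∣; _-_; ⁅_⁆)
open import Data.Fin.Subset.Properties using (x∈p∧x≢y⇒x∈p-y; p─q⊆p)
open import Data.List using (List; []; _∷_; _++_; length; filterᵇ; allFin; tabulate)
open import Data.List.Properties using (length-tabulate)
open import Data.List.Relation.Unary.All as All using (All; []; _∷_)
open import Data.List.Relation.Unary.AllPairs using ([]; _∷_)
open import Data.List.Relation.Unary.Any using (here; there)
open import Data.List.Relation.Unary.Unique.Propositional using (Unique)
open import Data.Nat using (ℕ; zero; suc; _+_; _*_; _≤_; _<_; z≤n; s≤s; _<?_)
open import Data.Nat.Properties hiding (_≟_)
open import Algebra.Properties.CommutativeSemigroup +-commutativeSemigroup using (interchange)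
open import Data.Nat.Tactic.RingSolver using (solve-∀)
open import Data.Product using (Σ; ∃; _×_; _,_; proj₁; proj₂)
open import Data.Sum using (_⊎_; inj₁; inj₂)
open import Data.Unit using (⊤; tt)
open import Data.Vec using (lookup; []; _∷_)
import Data.Vec as Vec
open import Data.Vec.Base using () renaming (there to there[]=)
open import Data.Vec.Properties using ([]=⇒lookup; lookup⇒[]=; lookup∘tabulate)
open import Function.Bundles using (_⇔_; mk⇔; Equivalence)
open import Relation.Binary using (tri<; tri≈; tri>)
open import Relation.Binary.PropositionalEquality using (_≡_; _≢_; refl; sym; trans; cong; cong₂; subst; subst₂; ≢-sym; module ≡-Reasoning)
open import Relation.Nullary using (¬_; yes; no; does)
open import Relation.Nullary.Decidable using (dec-true; dec-false)

∧-projˡ : ∀ {a b} → (a ∧ b) ≡ true → a ≡ true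
∧-projˡ {true} _ = refl

∧-projʳ : ∀ {a b} → (a ∧ b) ≡ true → b ≡ true
∧-projʳ {true} e = e

∧-intro : ∀ {a b} → a ≡ true → b ≡ true → (a ∧ b) ≡ true
∧-intro refl refl = refl

∨-elim : ∀ {a b} → (a ∨ b) ≡ true → a ≡ true ⊎ b ≡ true
∨-elim {true} _ = inj₁ refl
∨-elim {false} e = inj₂ e

∨-introˡ : ∀ {a} b → a ≡ true → (a ∨ b) ≡ true
∨-introˡ _ refl = refl

∨-introʳ : ∀ a {b} → b ≡ true → (a ∨ b) ≡ true
∨-introʳ true _ = refl
∨-introʳ false e = e

∨-false : ∀ {a b} → (a ∨ b) ≡ false → a ≡ false × b ≡ false
∨-false {false} e = refl , e

not-true : ∀ {a} → not a ≡ true → a ≡ false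
not-true {false} _ = refl

not-false : ∀ {a} → a ≡ false → not a ≡ true
not-false refl = refl

true≢false : ∀ {a} → a ≡ true → a ≡ false → ⊥
true≢false refl ()

ind : Bool → ℕ
ind true = 1
ind false = 0

ind≤1 : ∀ b → ind b ≤ 1
ind≤1 true = ≤-refl
ind≤1 false = z≤n

module _ {A : Set} where

  count : (A → Bool) → List A → ℕ
  count f [] = 0
  count f (x ∷ xs) = ind (f x) + count f xs

  count-++ : ∀ (f : A → Bool) xs ys → count f (xs ++ ys) ≡ count f xs + count f ys
  count-++ f [] ys = refl
  count-++ f (x ∷ xs) ys = trans (cong (ind (f x) +_) (count-++ f xs ys)) (sym (+-assoc (ind (f x)) _ _))

  count-cong : ∀ {f g} → (∀ x → f x ≡ g x) → ∀ xs → count f xs ≡ count g xs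
  count-cong f≗g [] = refl
  count-cong f≗g (x ∷ xs) = cong₂ _+_ (cong ind (f≗g x)) (count-cong f≗g xs)

  count-mono : ∀ {f g} → (∀ x → f x ≡ true → g x ≡ true) → ∀ xs → count f xs ≤ count g xs
  count-mono f⇒g [] = z≤n
  count-mono {f} f⇒g (x ∷ xs) = +-mono-≤ (ind-mono (f x) (f⇒g x)) (count-mono f⇒g xs)
    where
    ind-mono : ∀ a {b} → (a ≡ true → b ≡ true) → ind a ≤ ind b
    ind-mono false _ = z≤n
    ind-mono true a⇒b rewrite a⇒b refl = ≤-refl

  count-∨ : ∀ (f g : A → Bool) xs → count (λ x → f x ∨ g x) xs ≤ count f xs + count g xs
  count-∨ f g [] = z≤n
  count-∨ f g (x ∷ xs) = begin
      ind (f x ∨ g x) + count (λ x → f x ∨ g x) xs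
    ≤⟨ +-mono-≤ (ind-∨ (f x) (g x)) (count-∨ f g xs) ⟩
      (ind (f x) + ind (g x)) + (count f xs + count g xs)
    ≡⟨ interchange (ind (f x)) _ _ _ ⟩
      count f (x ∷ xs) + count g (x ∷ xs) ∎
    where
    open ≤-Reasoning
    ind-∨ : ∀ a b → ind (a ∨ b) ≤ ind a + ind b
    ind-∨ true _ = s≤s z≤n
    ind-∨ false _ = ≤-refl

  count-split : ∀ (f g : A → Bool) xs → count f xs ≡ count (λ x → f x ∧ g x) xs + count (λ x → f x ∧ not (g x)) xs
  count-split f g [] = refl
  count-split f g (x ∷ xs) =
    trans (cong₂ _+_ (ind-split (f x) (g x)) (count-split f g xs)) (interchange (ind (f x ∧ g x)) (ind (f x ∧ not (g x))) (count (λ x → f x ∧ g x) xs) _)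
    where
    ind-split : ∀ a b → ind a ≡ ind (a ∧ b) + ind (a ∧ not b)
    ind-split true true = refl
    ind-split true false = refl
    ind-split false _ = refl

  count-avoiding : ∀ (h a b : A → Bool) xs →
    count h xs ≤ count a xs + count b xs + count (λ x → h x ∧ (not (a x) ∧ not (b x))) xs
  count-avoiding h a b xs = ≤-trans (count-mono covered xs) (≤-trans (count-∨ (λ x → a x ∨ b x) _ xs) (+-monoˡ-≤ _ (count-∨ a b xs)))
    where
    covered : ∀ x → h x ≡ true → ((a x ∨ b x) ∨ (h x ∧ (not (a x) ∧ not (b x)))) ≡ true
    covered x hx with a x | b x
    ... | true | _ = refl
    ... | false | true = refl
    ... | false | false rewrite hx = refl

  count-true : ∀ xs → count (λ _ → true) xs ≡ length xs
  count-true [] = refl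
  count-true (_ ∷ xs) = cong suc (count-true xs)

  count-false : ∀ {f} → (∀ x → f x ≡ false) → ∀ xs → count f xs ≡ 0
  count-false f≗false [] = refl
  count-false f≗false (x ∷ xs) rewrite f≗false x = count-false f≗false xs

  count-tail≤ : ∀ (f : A → Bool) x xs → count f xs ≤ count f (x ∷ xs)
  count-tail≤ f x xs = m≤n+m _ (ind (f x))

  count-filter : ∀ (g f : A → Bool) xs → count f (filterᵇ g xs) ≡ count (λ x → g x ∧ f x) xs
  count-filter g f [] = refl
  count-filter g f (x ∷ xs) with g x
  ... | true = cong (ind (f x) +_) (count-filter g f xs)
  ... | false = count-filter g f xs

  length-filter : ∀ (g : A → Bool) xs → length (filterᵇ g xs) ≡ count g xs
  length-filter g xs =
    trans (sym (count-true (filterᵇ g xs))) (trans (count-filter g _ xs) (count-cong (λ x → ∧-identityʳ (g x)) xs))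

  count-witness : ∀ (f : A → Bool) xs → 1 ≤ count f xs → ∃ λ x → f x ≡ true
  count-witness f (x ∷ xs) pos with f x in fx
  ... | true = x , fx
  ... | false = count-witness f xs pos

module _ {V : Set} where

  last : V → List V → V
  last x [] = x
  last _ (y ∷ ys) = last y ys

  last-++ : ∀ (x : V) xs ys → last x (xs ++ ys) ≡ last (last x xs) ys
  last-++ x [] ys = refl
  last-++ _ (y ∷ xs) ys = last-++ y xs ys

  data Chain (R : V → V → Set) : V → List V → Set where
    [] : ∀ {x} → Chain R x []
    _∷_ : ∀ {x y ys} → R x y → Chain R y ys → Chain R x (y ∷ ys)

  chain-++ : ∀ {R x xs ys} → Chain R x xs → Chain R (last x xs) ys → Chain R x (xs ++ ys)
  chain-++ [] c = c
  chain-++ (r ∷ c₁) c₂ = r ∷ chain-++ c₁ c₂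

  chain-map : ∀ {R S : V → V → Set} → (∀ {a b} → R a b → S a b) → ∀ {x xs} → Chain R x xs → Chain S x xs
  chain-map f [] = []
  chain-map f (r ∷ c) = f r ∷ chain-map f c

  trivial-chain : ∀ x xs → Chain (λ _ _ → ⊤) x xs
  trivial-chain x [] = []
  trivial-chain x (y ∷ ys) = tt ∷ trivial-chain y ys

  data Consecutive : V → List V → V → V → Set where
    here : ∀ {x y ys} → Consecutive x (y ∷ ys) x y
    there : ∀ {x y ys p q} → Consecutive y ys p q → Consecutive x (y ∷ ys) p q

  chain-consecutive : ∀ {R h t p q} → Chain R h t → Consecutive h t p q → R p q
  chain-consecutive (r ∷ _) here = r
  chain-consecutive (_ ∷ c) (there k) = chain-consecutive c k

  _≈ₘ_ : List V → List V → Set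
  xs ≈ₘ ys = ∀ f → count f xs ≡ count f ys

  -- reverse-onto h t m = (last h t , rest) where last h t ∷ rest is the reversal of h ∷ t followed by m
  reverse-onto : V → List V → List V → V × List V
  reverse-onto h [] m = h , m
  reverse-onto h (y ∷ ys) m = reverse-onto y ys (h ∷ m)

  reverse-onto-head : ∀ h t m → proj₁ (reverse-onto h t m) ≡ last h t
  reverse-onto-head h [] m = refl
  reverse-onto-head h (y ∷ ys) m = reverse-onto-head y ys (h ∷ m)

  reverse-onto-last : ∀ h t m → last (proj₁ (reverse-onto h t m)) (proj₂ (reverse-onto h t m)) ≡ last h m
  reverse-onto-last h [] m = refl
  reverse-onto-last h (y ∷ ys) m = reverse-onto-last y ys (h ∷ m)

  reverse-onto-count : ∀ f h t m →
    count f (proj₁ (reverse-onto h t m) ∷ proj₂ (reverse-onto h t m)) ≡ count f (h ∷ t) + count f m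
  reverse-onto-count f h [] m = cong (_+ count f m) (sym (+-identityʳ (ind (f h))))
  reverse-onto-count f h (y ∷ ys) m =
    trans (reverse-onto-count f y ys (h ∷ m)) (shuffle (ind (f y)) (count f ys) (ind (f h)) (count f m))
    where
    shuffle : ∀ a b c d → a + b + (c + d) ≡ c + (a + b) + d
    shuffle = solve-∀

  reverse-onto-chain : ∀ {R : V → V → Set} → (∀ {a b} → R a b → R b a) →
    ∀ h t m → Chain R h t → Chain R h m → Chain R (proj₁ (reverse-onto h t m)) (proj₂ (reverse-onto h t m))
  reverse-onto-chain R-sym h [] m _ c = c
  reverse-onto-chain R-sym h (y ∷ ys) m (r ∷ c₁) c₂ = reverse-onto-chain R-sym y ys (h ∷ m) c₁ (R-sym r ∷ c₂)

-- A path is a list h ∷ t of vertices; a break is a consecutive pair that is not r-adjacent.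
-- A break (p , q) is removed by an exchange: a consecutive pair (a , b) with p ~ a and q ~ b,
-- after which reversing the segment between them (a 2-opt move) strictly decreases the
-- number of breaks. The invariant Q (implied by r) is preserved by every move.
module BreakElimination {V : Set} (r : V → V → Bool) (r-sym : ∀ x y → r x y ≡ r y x)
    (r-irrefl : ∀ x → r x x ≡ false) (Q : V → V → Set) (Q-sym : ∀ {a b} → Q a b → Q b a)
    (r⇒Q : ∀ {a b} → r a b ≡ true → Q a b) where

  breaks : V → List V → ℕ
  breaks x [] = 0
  breaks x (y ∷ ys) = ind (not (r x y)) + breaks y ys

  breaks-++ : ∀ x xs ys → breaks x (xs ++ ys) ≡ breaks x xs + breaks (last x xs) ys
  breaks-++ x [] ys = refl
  breaks-++ x (y ∷ xs) ys =
    trans (cong (ind (not (r x y)) +_) (breaks-++ y xs ys)) (sym (+-assoc (ind (not (r x y))) _ _))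

  breaks-reverse-onto : ∀ h t m → breaks (proj₁ (reverse-onto h t m)) (proj₂ (reverse-onto h t m)) ≡ breaks h t + breaks h m
  breaks-reverse-onto h [] m = refl
  breaks-reverse-onto h (y ∷ ys) m =
    trans (breaks-reverse-onto y ys (h ∷ m))
      (trans (cong (λ b → breaks y ys + (ind (not b) + breaks h m)) (r-sym y h))
        (shuffle (breaks y ys) (ind (not (r h y))) (breaks h m)))
    where
    shuffle : ∀ a b c → a + (b + c) ≡ b + a + c
    shuffle = solve-∀

  breaks≡0⇒chain : ∀ h t → breaks h t ≡ 0 → Chain (λ a b → r a b ≡ true) h t
  breaks≡0⇒chain h [] _ = []
  breaks≡0⇒chain h (y ∷ ys) none with r h y in hy
  ... | true = hy ∷ breaks≡0⇒chain y ys none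

  exchange : V → V → V → List V → Bool
  exchange p q x [] = false
  exchange p q x (y ∷ ys) = (r p x ∧ r q y) ∨ exchange p q y ys

  -- Starting from the reversed segment a ∷ acc (whose last entry is q), walk along rest until an
  -- exchange (a' , b) for the break (p , q) is found; then p a' (reversed segment) q b … closes it.
  splice : (p q a : V) (acc rest : List V) → last a acc ≡ q → exchange p q a rest ≡ true →
    Σ (List V) λ t → (breaks p t < suc (breaks a acc + breaks a rest))
      × (∀ f → count f t ≡ count f (a ∷ acc) + count f rest) × (last p t ≡ last a rest)
      × (Chain Q a acc → Chain Q a rest → Chain Q p t)
  splice p q a acc [] _ ()
  splice p q a acc (b ∷ zs) acc-q ex with r p a ∧ r q b in found
  ... | true = a ∷ (acc ++ b ∷ zs) , fewer , same , last-++ a acc (b ∷ zs) , chain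
    where
    pa : r p a ≡ true
    pa = ∧-projˡ {r p a} found
    qb : r q b ≡ true
    qb = ∧-projʳ {r p a} found
    fewer : breaks p (a ∷ (acc ++ b ∷ zs)) < suc (breaks a acc + breaks a (b ∷ zs))
    fewer rewrite pa | breaks-++ a acc (b ∷ zs) | acc-q | qb =
      s≤s (+-monoʳ-≤ (breaks a acc) (m≤n+m (breaks b zs) (ind (not (r a b)))))
    same : ∀ f → count f (a ∷ (acc ++ b ∷ zs)) ≡ count f (a ∷ acc) + count f (b ∷ zs)
    same f = trans (cong (ind (f a) +_) (count-++ f acc (b ∷ zs))) (sym (+-assoc (ind (f a)) _ _))
    chain : Chain Q a acc → Chain Q a (b ∷ zs) → Chain Q p (a ∷ (acc ++ b ∷ zs))
    chain c₁ (_ ∷ c₂) = r⇒Q pa ∷ chain-++ c₁ (subst (λ z → Q z b) (sym acc-q) (r⇒Q qb) ∷ c₂)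
  ... | false =
    let t , fewer , same , end , chain = splice p q b (a ∷ acc) zs acc-q ex in
    t , ≤-trans fewer (≤-reflexive (cong suc (shift-break (r b a) (r a b) (r-sym b a)))) ,
    (λ f → trans (same f) (shuffle (ind (f b)) (ind (f a)) (count f acc) (count f zs))) ,
    end , (λ { c₁ (ab ∷ c₂) → chain (Q-sym ab ∷ c₁) c₂ })
    where
    shift-break : ∀ x y → x ≡ y → ind (not x) + breaks a acc + breaks b zs ≡ breaks a acc + (ind (not y) + breaks b zs)
    shift-break x _ refl = shuffle₃ (ind (not x)) (breaks a acc) (breaks b zs)
      where
      shuffle₃ : ∀ u v w → u + v + w ≡ v + (u + w)
      shuffle₃ = solve-∀
    shuffle : ∀ u v w x → u + (v + w) + x ≡ v + w + (u + x)
    shuffle = solve-∀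

  -- The path represented is reverse (x ∷ acc) ++ rest.
  BreakCondition : V → List V → List V → Set
  BreakCondition x acc rest =
    ∀ p q → Consecutive x rest p q → r p q ≡ false → (exchange q p x acc ∨ exchange p q x rest) ≡ true

  Rearrangement : V → List V → List V → ℕ → Set
  Rearrangement x acc rest bound = Σ (V × List V) λ (h , t) →
      (breaks h t < bound)
    × (∀ f → count f (h ∷ t) ≡ count f (x ∷ acc) + count f rest)
    × (h ≡ last x acc) × (last h t ≡ last x rest)
    × (Chain Q x acc → Chain Q x rest → Chain Q h t)

  Rearranged : V → List V → List V → Set
  Rearranged x acc rest = Rearrangement x acc rest (breaks x acc + breaks x rest)

  close-forward : ∀ x acc y ys → exchange x y y ys ≡ true → Rearrangement x acc (y ∷ ys) (breaks x acc + suc (breaks y ys))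
  close-forward x acc y ys forward =
    let t , fewer , same , end , chain = splice x y y [] ys refl forward in
    reverse-onto x acc t ,
    ≤-trans (≤-reflexive (cong suc (breaks-reverse-onto x acc t)))
      (≤-trans (≤-reflexive (sym (+-suc (breaks x acc) (breaks x t)))) (+-monoʳ-≤ (breaks x acc) fewer)) ,
    (λ f → trans (reverse-onto-count f x acc t)
             (cong (count f (x ∷ acc) +_) (trans (same f) (cong (_+ count f ys) (+-identityʳ (ind (f y))))))) ,
    reverse-onto-head x acc t ,
    trans (reverse-onto-last x acc t) end ,
    (λ { c₁ (_ ∷ c₂) → reverse-onto-chain Q-sym x acc t c₁ (chain [] c₂) })

  close-backward : ∀ x acc y ys → exchange y x x acc ≡ true → Rearrangement x acc (y ∷ ys) (breaks x acc + suc (breaks y ys))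
  close-backward x acc y ys backward =
    let t , fewer , same , end , chain = splice y x x [] acc refl backward in
    reverse-onto y t ys ,
    ≤-trans (≤-reflexive (cong suc (breaks-reverse-onto y t ys)))
      (≤-trans (+-monoˡ-≤ (breaks y ys) fewer) (≤-reflexive (sym (+-suc (breaks x acc) (breaks y ys))))) ,
    (λ f → trans (reverse-onto-count f y t ys)
             (trans (cong (λ c → ind (f y) + c + count f ys) (trans (same f) (cong (_+ count f acc) (+-identityʳ (ind (f x))))))
               (shuffle (ind (f y)) (ind (f x)) (count f acc) (count f ys)))) ,
    trans (reverse-onto-head y t ys) end ,
    reverse-onto-last y t ys ,
    (λ { c₁ (_ ∷ c₂) → reverse-onto-chain Q-sym y t ys (chain [] c₁) c₂ })
    where
    shuffle : ∀ u v w x → u + (v + w) + x ≡ v + w + (u + x)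
    shuffle = solve-∀

  close-first-break : (x : V) (acc rest : List V) → BreakCondition x acc rest → 1 ≤ breaks x rest → Rearranged x acc rest
  close-first-break x acc [] _ ()
  close-first-break x acc (y ∷ ys) cond broken with r x y in xy
  ... | true =
    let o , fewer , same , start , end , chain = close-first-break y (x ∷ acc) ys cond′ broken in
    o , ≤-trans fewer (≤-reflexive (cong (λ b → ind (not b) + breaks x acc + breaks y ys) (trans (r-sym y x) xy))) ,
    (λ f → trans (same f) (shuffle (ind (f y)) (ind (f x)) (count f acc) (count f ys))) ,
    start , end , (λ c₁ → λ { (q ∷ c₂) → chain (Q-sym q ∷ c₁) c₂ })
    where
    cond′ : BreakCondition y (x ∷ acc) ys
    cond′ p q k pq rewrite ∧-comm (r q y) (r p x) = ∨-rotate (r p x ∧ r q y) _ _ (cond p q (there k) pq)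
      where
      ∨-rotate : ∀ a c e → (c ∨ (a ∨ e)) ≡ true → ((a ∨ c) ∨ e) ≡ true
      ∨-rotate true c e _ = refl
      ∨-rotate false true e _ = refl
      ∨-rotate false false e h = h
    shuffle : ∀ u v w x → u + (v + w) + x ≡ v + w + (u + x)
    shuffle = solve-∀
  ... | false with exchange x y y ys in forward
  ...   | true = close-forward x acc y ys forward
  ...   | false = close-backward x acc y ys backward
    where
    backward : exchange y x x acc ≡ true
    backward with cond x y here xy
    ... | found rewrite r-irrefl x | forward = trans (sym (∨-identityʳ _)) found

  reduce-breaks : (h : V) (t : List V) → (∀ p q → Consecutive h t p q → r p q ≡ false → exchange p q h t ≡ true) →
    1 ≤ breaks h t → Σ (List V) λ t′ → (breaks h t′ < breaks h t) × (h ∷ t′) ≈ₘ (h ∷ t)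
      × (last h t′ ≡ last h t) × (Chain Q h t → Chain Q h t′)
  reduce-breaks h t exchanges broken with close-first-break h [] t exchanges broken
  ... | (.h , t′) , fewer , same , refl , end , chain =
    t′ , fewer , (λ f → trans (same f) (cong (_+ count f t) (+-identityʳ (ind (f h))))) , end , chain []

  ExchangeCondition : V → List V → V → Set
  ExchangeCondition h L z = ∀ t → Chain Q h t → (h ∷ t) ≈ₘ L → last h t ≡ z →
    ∀ p q → Consecutive h t p q → r p q ≡ false → exchange p q h t ≡ true

  eliminate-breaks : ∀ h L z → ExchangeCondition h L z → ∀ t → Chain Q h t → (h ∷ t) ≈ₘ L → last h t ≡ z →
    Σ (List V) λ t* → Chain (λ a b → r a b ≡ true) h t* × (h ∷ t*) ≈ₘ L × last h t* ≡ z
  eliminate-breaks h L z exchanges t₀ = go (breaks h t₀) t₀ ≤-refl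
    where
    go : ∀ fuel t → breaks h t ≤ fuel → Chain Q h t → (h ∷ t) ≈ₘ L → last h t ≡ z →
      Σ (List V) λ t* → Chain (λ a b → r a b ≡ true) h t* × (h ∷ t*) ≈ₘ L × last h t* ≡ z
    go fuel t bound chain same end with breaks h t in bs
    ... | zero = t , breaks≡0⇒chain h t bs , same , end
    go zero t () chain same end | suc _
    go (suc fuel) t bound chain same end | suc _ =
      let t′ , fewer , same′ , end′ , chain′ = reduce-breaks h t (exchanges t chain same end) (subst (1 ≤_) (sym bs) (s≤s z≤n)) in
      go fuel t′ (≤-pred (≤-trans (subst (breaks h t′ <_) bs fewer) bound)) (chain′ chain) (λ f → trans (same′ f) (same f)) (trans end′ end)

-- If a break (p , q) had no exchange, then along the path every consecutive pair (a , b) misses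
-- p ~ a or q ~ b, so p and q together would have more non-neighbours than allowed.
module Exchanges {V : Set} (r : V → V → Bool) (r-sym : ∀ x y → r x y ≡ r y x)
    (r-irrefl : ∀ x → r x x ≡ false) (Q : V → V → Set) (Q-sym : ∀ {a b} → Q a b → Q b a)
    (r⇒Q : ∀ {a b} → r a b ≡ true → Q a b) (_==_ : V → V → Bool) (==-refl : ∀ x → (x == x) ≡ true) where

  open BreakElimination r r-sym r-irrefl Q Q-sym r⇒Q

  pairs : (V → V → Bool) → V → List V → ℕ
  pairs g x [] = 0
  pairs g x (y ∷ ys) = ind (g x y) + pairs g y ys

  pairs-true : ∀ h t → pairs (λ _ _ → true) h t ≡ length t
  pairs-true h [] = refl
  pairs-true h (y ∷ ys) = cong suc (pairs-true y ys)

  pair-bound : ∀ a b c d → (c ∧ d) ≡ false →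
    ind (a ∧ b) + ind (a ∧ b ∧ not c ∧ not d) ≤ ind (a ∧ not c) + ind (b ∧ not d)
  pair-bound true true true true ()
  pair-bound true true true false _ = ≤ᵇ⇒≤ _ _ tt
  pair-bound true true false true _ = ≤ᵇ⇒≤ _ _ tt
  pair-bound true true false false _ = ≤ᵇ⇒≤ _ _ tt
  pair-bound true false true true ()
  pair-bound true false true false _ = ≤ᵇ⇒≤ _ _ tt
  pair-bound true false false true _ = ≤ᵇ⇒≤ _ _ tt
  pair-bound true false false false _ = ≤ᵇ⇒≤ _ _ tt
  pair-bound false true true true ()
  pair-bound false true true false _ = ≤ᵇ⇒≤ _ _ tt
  pair-bound false true false true _ = ≤ᵇ⇒≤ _ _ tt
  pair-bound false true false false _ = ≤ᵇ⇒≤ _ _ tt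
  pair-bound false false true true ()
  pair-bound false false true false _ = ≤ᵇ⇒≤ _ _ tt
  pair-bound false false false true _ = ≤ᵇ⇒≤ _ _ tt
  pair-bound false false false false _ = ≤ᵇ⇒≤ _ _ tt

  no-exchange⇒non-neighbours : ∀ p q (X Y : V → Bool) h t → exchange p q h t ≡ false →
    pairs (λ a b → X a ∧ Y b) h t + pairs (λ a b → X a ∧ Y b ∧ not (r p a) ∧ not (r q b)) h t
      ≤ count (λ a → X a ∧ not (r p a)) (h ∷ t) + count (λ b → Y b ∧ not (r q b)) t
  no-exchange⇒non-neighbours p q X Y h [] _ = z≤n
  no-exchange⇒non-neighbours p q X Y h (y ∷ ys) none with ∨-false {r p h ∧ r q y} none
  ... | here-none , later-none = begin
      ind (X h ∧ Y y) + pairs XY y ys + (ind (X h ∧ Y y ∧ not (r p h) ∧ not (r q y)) + pairs XY¬¬ y ys)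
    ≡⟨ interchange (ind (X h ∧ Y y)) (pairs XY y ys) _ _ ⟩
      ind (X h ∧ Y y) + ind (X h ∧ Y y ∧ not (r p h) ∧ not (r q y)) + (pairs XY y ys + pairs XY¬¬ y ys)
    ≤⟨ +-mono-≤ (pair-bound (X h) (Y y) (r p h) (r q y) here-none) (no-exchange⇒non-neighbours p q X Y y ys later-none) ⟩
      ind (X h ∧ not (r p h)) + ind (Y y ∧ not (r q y)) + (count X¬p (y ∷ ys) + count Y¬q ys)
    ≡⟨ interchange (ind (X h ∧ not (r p h))) _ _ _ ⟩
      count X¬p (h ∷ y ∷ ys) + count Y¬q (y ∷ ys) ∎
    where
    open ≤-Reasoning
    XY XY¬¬ : V → V → Bool
    XY a b = X a ∧ Y b
    XY¬¬ a b = X a ∧ Y b ∧ not (r p a) ∧ not (r q b)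
    X¬p Y¬q : V → Bool
    X¬p a = X a ∧ not (r p a)
    Y¬q b = Y b ∧ not (r q b)

  break⇒nonadjacent-pair : ∀ {h t p q} → Consecutive h t p q → 1 ≤ pairs (λ a b → not (r p a) ∧ not (r q b)) h t
  break⇒nonadjacent-pair {p = p} {q} here rewrite r-irrefl p | r-irrefl q = s≤s z≤n
  break⇒nonadjacent-pair {h} {y ∷ ys} {p} {q} (there k) =
    ≤-trans (break⇒nonadjacent-pair k) (m≤n+m _ (ind (not (r p h) ∧ not (r q y))))

  consecutive-first∈ : ∀ {h t p q} → Consecutive h t p q → 1 ≤ count (_== p) (h ∷ t)
  consecutive-first∈ {h} here rewrite ==-refl h = s≤s z≤n
  consecutive-first∈ {h} (there k) = ≤-trans (consecutive-first∈ k) (m≤n+m _ (ind (h == _)))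

  consecutive-second∈ : ∀ {h t p q} → Consecutive h t p q → 1 ≤ count (_== q) t
  consecutive-second∈ {t = y ∷ _} here rewrite ==-refl y = s≤s z≤n
  consecutive-second∈ {t = y ∷ _} (there k) = ≤-trans (consecutive-second∈ k) (m≤n+m _ (ind (y == _)))

  -- The bound d + 1 counts p itself, as r is irreflexive.
  dense⇒exchanges : (d : ℕ) (h : V) (L : List V) (z : V) → 3 + (d + d) ≤ length L →
    (∀ p → 1 ≤ count (_== p) L → count (λ w → not (r p w)) L ≤ suc d) → ExchangeCondition h L z
  dense⇒exchanges d h L z long sparse t _ same _ p q k pq with exchange p q h t in ex
  ... | true = refl
  ... | false = ⊥-elim (<-irrefl refl (≤-trans long′ too-short))
    where
    p-bound : count (λ w → not (r p w)) (h ∷ t) ≤ suc d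
    p-bound = subst (_≤ suc d) (sym (same _)) (sparse p (subst (1 ≤_) (same _) (consecutive-first∈ k)))
    q-bound : count (λ w → not (r q w)) t ≤ suc d
    q-bound = ≤-trans (count-tail≤ _ h t)
      (subst (_≤ suc d) (sym (same _)) (sparse q (subst (1 ≤_) (same _) (≤-trans (consecutive-second∈ k) (count-tail≤ _ h t)))))
    counted : length t + 1 ≤ suc d + suc d
    counted = ≤-trans (+-mono-≤ (≤-reflexive (sym (pairs-true h t))) (break⇒nonadjacent-pair k))
      (≤-trans (no-exchange⇒non-neighbours p q (λ _ → true) (λ _ → true) h t ex) (+-mono-≤ p-bound q-bound))
    long′ : 3 + (d + d) ≤ suc (length t)
    long′ = subst (3 + (d + d) ≤_) (trans (sym (count-true L)) (trans (sym (same _)) (cong suc (count-true t)))) long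
    too-short : suc (length t) ≤ 2 + (d + d)
    too-short = subst₂ _≤_ (+-comm (length t) 1) (+-suc (suc d) d) counted

  -- Every Q-step leaves `side` and the path starts and ends off it, so each of the k vertices of
  -- that side is entered once and left once.
  module Alternating (side : V → Bool) (Q-leaves : ∀ {a b} → Q a b → side a ≡ true → side b ≡ false) where

    Q-enters : ∀ {a b} → Q a b → side b ≡ true → side a ≡ false
    Q-enters q = Q-leaves (Q-sym q)

    entries : ∀ h t → Chain Q h t → pairs (λ a b → not (side a) ∧ side b) h t ≡ count side t
    entries h [] _ = refl
    entries h (y ∷ ys) (q ∷ c) = cong₂ _+_ (entry (side h) (side y) (Q-enters q)) (entries y ys c)
      where
      entry : ∀ a b → (b ≡ true → a ≡ false) → ind (not a ∧ b) ≡ ind b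
      entry a false _ = cong ind (∧-zeroʳ (not a))
      entry a true a-off rewrite a-off refl = refl

    exits : ∀ h t → Chain Q h t → pairs (λ a b → side a ∧ not (side b)) h t + ind (side (last h t)) ≡ count side (h ∷ t)
    exits h [] _ = sym (+-identityʳ _)
    exits h (y ∷ ys) (q ∷ c) =
      trans (+-assoc (ind (side h ∧ not (side y))) _ _) (cong₂ _+_ (exit (side h) (side y) (Q-leaves q)) (exits y ys c))
      where
      exit : ∀ a b → (a ≡ true → b ≡ false) → ind (a ∧ not b) ≡ ind a
      exit false _ _ = refl
      exit true b b-off rewrite b-off refl = refl

    alternating⇒exchanges : (k : ℕ) (h : V) (L : List V) (z : V) → side h ≡ false → side z ≡ false → count side L ≡ k →
      (∀ {a b} → Q a b → r a b ≡ false → side a ≡ side b → ⊥) →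
      (∀ u w → side u ≡ true → side w ≡ false → r u w ≡ false →
         count (λ a → not (side a) ∧ not (r u a)) L + count (λ b → side b ∧ not (r w b)) L < k) →
      ExchangeCondition h L z
    alternating⇒exchanges k h L z h-off z-off size crossing sparse t chain same end p q k′ pq with exchange p q h t in ex
    ... | true = refl
    ... | false with side p in sp | side q in sq
    ...   | true | true = ⊥-elim (crossing (chain-consecutive chain k′) pq (trans sp (sym sq)))
    ...   | false | false = ⊥-elim (crossing (chain-consecutive chain k′) pq (trans sp (sym sq)))
    ...   | true | false = ⊥-elim (<-irrefl refl (≤-trans (sparse p q sp sq pq) (begin
        k                                                                            ≡⟨ sym counted ⟩
        pairs (λ a b → not (side a) ∧ side b) h t                                     ≤⟨ m≤m+n _ _ ⟩
        _                                                                            ≤⟨ no-exchange⇒non-neighbours p q (λ a → not (side a)) side h t ex ⟩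
        count (λ a → not (side a) ∧ not (r p a)) (h ∷ t) + count (λ b → side b ∧ not (r q b)) t
          ≤⟨ +-mono-≤ (≤-reflexive (same _)) (≤-trans (count-tail≤ _ h t) (≤-reflexive (same _))) ⟩
        count (λ a → not (side a) ∧ not (r p a)) L + count (λ b → side b ∧ not (r q b)) L ∎)))
      where
      open ≤-Reasoning
      counted : pairs (λ a b → not (side a) ∧ side b) h t ≡ k
      counted = trans (entries h t chain) (trans (cong (λ b → ind b + count side t) (sym h-off)) (trans (same side) size))
    ...   | false | true = ⊥-elim (<-irrefl refl (≤-trans (sparse q p sq sp (trans (r-sym q p) pq)) (begin
        k                                                                            ≡⟨ sym counted ⟩
        pairs (λ a b → side a ∧ not (side b)) h t                                     ≤⟨ m≤m+n _ _ ⟩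
        _                                                                            ≤⟨ no-exchange⇒non-neighbours p q side (λ a → not (side a)) h t ex ⟩
        count (λ a → side a ∧ not (r p a)) (h ∷ t) + count (λ b → not (side b) ∧ not (r q b)) t
          ≤⟨ +-mono-≤ (≤-reflexive (same _)) (≤-trans (count-tail≤ _ h t) (≤-reflexive (same _))) ⟩
        count (λ a → side a ∧ not (r p a)) L + count (λ b → not (side b) ∧ not (r q b)) L
          ≡⟨ +-comm (count (λ a → side a ∧ not (r p a)) L) _ ⟩
        count (λ a → not (side a) ∧ not (r q a)) L + count (λ b → side b ∧ not (r p b)) L ∎)))
      where
      open ≤-Reasoning
      counted : pairs (λ a b → side a ∧ not (side b)) h t ≡ k
      counted = trans (sym (+-identityʳ _))
        (trans (cong (λ b → pairs (λ a b → side a ∧ not (side b)) h t + ind b) (sym (trans (cong side end) z-off)))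
          (trans (exits h t chain) (trans (same side) size)))

module _ {n : ℕ} where

  _==_ : Fin n → Fin n → Bool
  x == y = does (x ≟ y)

  ==-refl : ∀ x → (x == x) ≡ true
  ==-refl x = dec-true (x ≟ x) refl

  ==-sound : ∀ {x y} → (x == y) ≡ true → x ≡ y
  ==-sound {x} {y} e with x ≟ y
  ... | yes x≡y = x≡y

  ==-≢ : ∀ {x y} → x ≢ y → (x == y) ≡ false
  ==-≢ {x} {y} x≢y = dec-false (x ≟ y) x≢y

count-tabulate : ∀ {n} {A : Set} (f : A → Bool) (g : Fin n → A) → count f (tabulate g) ≡ count (λ i → f (g i)) (allFin n)
count-tabulate {zero} f g = refl
count-tabulate {suc n} f g = cong (ind (f (g fzero)) +_)
  (trans (count-tabulate f (λ i → g (fsuc i))) (sym (count-tabulate (λ i → f (g i)) fsuc)))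

module _ {n : ℕ} where

  multiplicity : Fin n → List (Fin n) → ℕ
  multiplicity x = count (_== x)

  multiplicity-allFin : ∀ (x : Fin n) → multiplicity x (allFin n) ≡ 1
  multiplicity-allFin x = go x
    where
    go : ∀ {m} (x : Fin m) → count (_== x) (allFin m) ≡ 1
    go {suc m} fzero = cong suc (trans (count-tabulate {m} (_== fzero) fsuc) (count-false {f = λ i → fsuc i == fzero} (λ _ → refl) (allFin m)))
    go {suc m} (fsuc x) = trans (count-tabulate {m} (_== fsuc x) fsuc) (go x)

  count-point : ∀ (f : Fin n → Bool) s L → multiplicity s L ≡ 1 → count (λ w → f w ∧ (w == s)) L ≡ ind (f s)
  count-point f s L once = trans (count-cong at-s L) (by-value (f s))
    where
    at-s : ∀ w → (f w ∧ (w == s)) ≡ (f s ∧ (w == s))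
    at-s w with w == s in e
    ... | true = cong (λ v → f v ∧ true) (==-sound e)
    ... | false = trans (∧-zeroʳ (f w)) (sym (∧-zeroʳ (f s)))
    by-value : ∀ b → count (λ w → b ∧ (w == s)) L ≡ ind b
    by-value true = once
    by-value false = count-false {f = λ w → false ∧ (w == s)} (λ _ → refl) L

  count-remove : ∀ (f : Fin n → Bool) s L → multiplicity s L ≡ 1 → count f L ≡ ind (f s) + count (λ w → f w ∧ not (w == s)) L
  count-remove f s L once = trans (count-split f (_== s) L) (cong (_+ count (λ w → f w ∧ not (w == s)) L) (count-point f s L once))

  count-pos : ∀ (f : Fin n → Bool) s → f s ≡ true → 1 ≤ count f (allFin n)
  count-pos f s fs rewrite count-remove f s (allFin n) (multiplicity-allFin s) | fs = s≤s z≤n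

  count≡0 : ∀ (f : Fin n → Bool) s → count f (allFin n) ≡ 0 → f s ≡ false
  count≡0 f s none with f s in fs
  ... | true = ⊥-elim (<-irrefl refl (subst (0 <_) none (count-pos f s fs)))
  ... | false = refl

  count≤1 : ∀ (f : Fin n → Bool) → (∀ w w′ → f w ≡ true → f w′ ≡ true → w ≡ w′) → count f (allFin n) ≤ 1
  count≤1 f unique with count f (allFin n) in e
  ... | zero = z≤n
  ... | suc _ with count-witness f (allFin n) (subst (1 ≤_) (sym e) (s≤s z≤n))
  ...   | w₀ , fw₀ = subst (_≤ 1) e (≤-trans (count-mono only-w₀ (allFin n)) (≤-reflexive (multiplicity-allFin w₀)))
    where
    only-w₀ : ∀ w → f w ≡ true → (w == w₀) ≡ true
    only-w₀ w fw = subst (λ v → (w == v) ≡ true) (unique w w₀ fw fw₀) (==-refl w)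

  count≤2 : ∀ (f : Fin n → Bool) a b → (∀ w → f w ≡ true → w ≡ a ⊎ w ≡ b) → count f (allFin n) ≤ 2
  count≤2 f a b among = ≤-trans (count-mono a-or-b (allFin n))
    (≤-trans (count-∨ (_== a) (_== b) (allFin n)) (≤-reflexive (cong₂ _+_ (multiplicity-allFin a) (multiplicity-allFin b))))
    where
    a-or-b : ∀ w → f w ≡ true → ((w == a) ∨ (w == b)) ≡ true
    a-or-b w fw with among w fw
    ... | inj₁ refl = ∨-introˡ _ (==-refl w)
    ... | inj₂ refl = ∨-introʳ (w == a) (==-refl w)

  count≥3 : ∀ (f : Fin n → Bool) a b c → f a ≡ true → f b ≡ true → f c ≡ true → a ≢ b → a ≢ c → b ≢ c →
    3 ≤ count f (allFin n)
  count≥3 f a b c fa fb fc a≢b a≢c b≢c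
    rewrite count-remove f a (allFin n) (multiplicity-allFin a) | fa
          | count-remove (λ w → f w ∧ not (w == a)) b (allFin n) (multiplicity-allFin b) | fb | ==-≢ (≢-sym a≢b) =
    s≤s (s≤s (count-pos _ c (∧-intro (∧-intro fc (not-false (==-≢ (≢-sym a≢c)))) (not-false (==-≢ (≢-sym b≢c))))))

  ∈⇒lookup : ∀ {S : Subset n} {x} → x ∈ S → lookup S x ≡ true
  ∈⇒lookup = []=⇒lookup

  lookup⇒∈ : ∀ {S : Subset n} {x} → lookup S x ≡ true → x ∈ S
  lookup⇒∈ {S} {x} = lookup⇒[]= x S

  x∈p-y⇒x∈p : ∀ {p : Subset n} {x y} → x ∈ p - y → x ∈ p
  x∈p-y⇒x∈p {p} {y = y} = p─q⊆p p ⁅ y ⁆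

  x∈p-y⇒x≢y : ∀ {p : Subset n} {x y} → x ∈ p - y → x ≢ y
  x∈p-y⇒x≢y {p} m refl = x∉p-x p _ m
    where
    x∉p-x : ∀ {m} (p : Subset m) x → x ∉ p - x
    x∉p-x (true ∷ p) fzero ()
    x∉p-x (false ∷ p) fzero ()
    x∉p-x (_ ∷ p) (fsuc x) (there[]= m) = x∉p-x p x m

∣∣≡count : ∀ {n} (S : Subset n) → ∣ S ∣ ≡ count (lookup S) (allFin n)
∣∣≡count [] = refl
∣∣≡count (true ∷ S) = cong suc (trans (∣∣≡count S) (sym (count-tabulate (lookup (true ∷ S)) fsuc)))
∣∣≡count (false ∷ S) = trans (∣∣≡count S) (sym (count-tabulate (lookup (false ∷ S)) fsuc))

deg≡count : ∀ {n} (G : Graph n) v → deg G v ≡ count (Graph.adj G v) (allFin n)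
deg≡count {n} G v =
  trans (∣∣≡count (Vec.tabulate (Graph.adj G v))) (count-cong (lookup∘tabulate (Graph.adj G v)) (allFin n))

module _ {n : ℕ} (G : Graph n) where

  edge-≢ : ∀ {u v} → Edge G u v → u ≢ v
  edge-≢ {u} uv refl = true≢false uv (Graph.irrefl G u)

  walk-first-step : ∀ {S u v} → WalkIn G S u v → u ≢ v → ∃ λ y → y ∈ S × Edge G u y
  walk-first-step here u≢v = ⊥-elim (u≢v refl)
  walk-first-step (step {v = y} y∈S uy _) _ = y , y∈S , uy

at : ∀ {A : Set} → A → List A → ℕ → A
at d [] i = d
at d (x ∷ xs) zero = x
at d (x ∷ xs) (suc i) = at d xs i

at-chain : ∀ {A : Set} {R : A → A → Set} {d x xs} → Chain R x xs →
  ∀ i → i < length xs → R (at d (x ∷ xs) i) (at d (x ∷ xs) (suc i))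
at-chain (r ∷ c) zero _ = r
at-chain (r ∷ c) (suc i) (s≤s i<) = at-chain c i i<

at-last : ∀ {A : Set} (d x : A) xs → at d (x ∷ xs) (length xs) ≡ last x xs
at-last d x [] = refl
at-last d x (y ∷ ys) = at-last d y ys

module _ {n : ℕ} where

  at-occurs : ∀ (d : Fin n) L i → i < length L → 1 ≤ multiplicity (at d L i) L
  at-occurs d (x ∷ L) zero _ rewrite ==-refl x = s≤s z≤n
  at-occurs d (x ∷ L) (suc i) (s≤s i<) = ≤-trans (at-occurs d L i i<) (m≤n+m _ (ind (x == at d L i)))

  at-repeated : ∀ (d : Fin n) L i j → i < j → j < length L → at d L i ≡ at d L j → 2 ≤ multiplicity (at d L i) L
  at-repeated d (x ∷ L) zero (suc j) _ (s≤s j<) e rewrite ==-refl x =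
    s≤s (subst (λ w → 1 ≤ multiplicity w L) (sym e) (at-occurs d L j j<))
  at-repeated d (x ∷ L) (suc i) (suc j) (s≤s i<j) (s≤s j<) e =
    ≤-trans (at-repeated d L i j i<j j< e) (m≤n+m _ (ind (x == at d L i)))

  at-surjective : ∀ (d y : Fin n) L → 1 ≤ multiplicity y L → ∃ λ i → i < length L × at d L i ≡ y
  at-surjective d y (x ∷ L) occurs with x == y in e
  ... | true = 0 , s≤s z≤n , ==-sound e
  ... | false = let i , i< , found = at-surjective d y L occurs in suc i , s≤s i< , found

toℕ-next : ∀ {m} (i : Fin (suc m)) → (toℕ (next i) ≡ suc (toℕ i) × suc (toℕ i) < suc m) ⊎ (toℕ (next i) ≡ 0 × toℕ i ≡ m)
toℕ-next {m} i with suc (toℕ i) <? suc m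
... | yes i+1< = inj₁ (toℕ-fromℕ< i+1< , i+1<)
... | no i+1≮ = inj₂ (refl , ≤-antisym (≤-pred (toℕ<n i)) (≮⇒≥ λ i< → i+1≮ (s≤s i<)))

hamiltonian-from-cycle : ∀ {n} (R : Fin n → Fin n → Set) (c : Fin n) (cs : List (Fin n)) → 3 ≤ n →
  Chain R c cs → R (last c cs) c → (c ∷ cs) ≈ₘ allFin n → Hamiltonian R
hamiltonian-from-cycle {suc m} R c cs 3≤n chain closing all = 3≤n , f , (injective , surjective) , steps
  where
  L : List (Fin (suc m))
  L = c ∷ cs
  once : ∀ x → multiplicity x L ≡ 1
  once x = trans (all _) (multiplicity-allFin x)
  length-L : length L ≡ suc m
  length-L = trans (sym (count-true L)) (trans (all _) (trans (count-true (allFin (suc m))) (length-tabulate (λ i → i))))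
  f : Fin (suc m) → Fin (suc m)
  f i = at c L (toℕ i)
  in-range : ∀ i → toℕ i < length L
  in-range i = subst (toℕ i <_) (sym length-L) (toℕ<n i)
  no-repeat : ∀ {i j} → toℕ i < toℕ j → f i ≡ f j → ⊥
  no-repeat {i} {j} i<j e = <-irrefl refl (≤-trans (at-repeated c L (toℕ i) (toℕ j) i<j (in-range j) e) (≤-reflexive (once _)))
  injective : ∀ {i j} → f i ≡ f j → i ≡ j
  injective {i} {j} e with <-cmp (toℕ i) (toℕ j)
  ... | tri≈ _ i≡j _ = toℕ-injective i≡j
  ... | tri< i<j _ _ = ⊥-elim (no-repeat i<j e)
  ... | tri> _ _ j<i = ⊥-elim (no-repeat j<i (sym e))
  surjective : ∀ y → ∃ λ i → ∀ {j} → j ≡ i → f j ≡ y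
  surjective y with at-surjective c y L (≤-reflexive (sym (once y)))
  ... | i , i< , found = fromℕ< (subst (i <_) length-L i<) ,
    λ { refl → trans (cong (at c L) (toℕ-fromℕ< (subst (i <_) length-L i<))) found }
  steps : ∀ i → R (f i) (f (next i))
  steps i with toℕ-next i
  ... | inj₁ (e , i+1<) = subst (λ w → R (f i) (at c L w)) (sym e)
      (at-chain chain (toℕ i) (subst (toℕ i <_) (sym (suc-injective length-L)) (≤-pred i+1<)))
  ... | inj₂ (e , i≡m) = subst (λ w → R (f i) (at c L w)) (sym e)
      (subst (λ w → R (at c L w) c) (sym (trans i≡m (sym (suc-injective length-L)))) (subst (λ w → R w c) (sym (at-last c c cs)) closing))

module _ {n : ℕ} where

  samePairᵇ : Fin n × Fin n → Fin n → Fin n → Bool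
  samePairᵇ (a , b) u v = ((a == u) ∧ (b == v)) ∨ ((a == v) ∧ (b == u))

  pairInᵇ : List (Fin n × Fin n) → Fin n → Fin n → Bool
  pairInᵇ [] u v = false
  pairInᵇ (e ∷ L) u v = samePairᵇ e u v ∨ pairInᵇ L u v

  samePairᵇ-sound : ∀ e u v → samePairᵇ e u v ≡ true → SamePair e u v
  samePairᵇ-sound (a , b) u v h with ∨-elim h
  ... | inj₁ h₁ = inj₁ (==-sound (∧-projˡ h₁) , ==-sound (∧-projʳ {a == u} h₁))
  ... | inj₂ h₂ = inj₂ (==-sound (∧-projˡ h₂) , ==-sound (∧-projʳ {a == v} h₂))

  samePairᵇ-complete : ∀ e u v → SamePair e u v → samePairᵇ e u v ≡ true
  samePairᵇ-complete (a , b) u v (inj₁ (refl , refl)) = ∨-introˡ _ (∧-intro (==-refl a) (==-refl b))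
  samePairᵇ-complete (a , b) u v (inj₂ (refl , refl)) = ∨-introʳ _ (∧-intro (==-refl a) (==-refl b))

  pairInᵇ-sound : ∀ L u v → pairInᵇ L u v ≡ true → PairIn L u v
  pairInᵇ-sound (e ∷ L) u v h with ∨-elim h
  ... | inj₁ h₁ = here (samePairᵇ-sound e u v h₁)
  ... | inj₂ h₂ = there (pairInᵇ-sound L u v h₂)

  pairInᵇ-complete : ∀ L u v → PairIn L u v → pairInᵇ L u v ≡ true
  pairInᵇ-complete (e ∷ L) u v (here p) = ∨-introˡ _ (samePairᵇ-complete e u v p)
  pairInᵇ-complete (e ∷ L) u v (there p) = ∨-introʳ (samePairᵇ e u v) (pairInᵇ-complete L u v p)

  samePairᵇ-sym : ∀ e u v → samePairᵇ e u v ≡ samePairᵇ e v u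
  samePairᵇ-sym (a , b) u v = ∨-comm ((a == u) ∧ (b == v)) _

  pairInᵇ-sym : ∀ L u v → pairInᵇ L u v ≡ pairInᵇ L v u
  pairInᵇ-sym [] u v = refl
  pairInᵇ-sym (e ∷ L) u v = cong₂ _∨_ (samePairᵇ-sym e u v) (pairInᵇ-sym L u v)

  samePairᵇ-partner : ∀ e u v v′ → samePairᵇ e u v ≡ true → samePairᵇ e u v′ ≡ true → v ≡ v′
  samePairᵇ-partner e u v v′ h h′ with samePairᵇ-sound e u v h | samePairᵇ-sound e u v′ h′
  ... | inj₁ (refl , refl) | inj₁ (refl , refl) = refl
  ... | inj₁ (refl , refl) | inj₂ (refl , refl) = refl
  ... | inj₂ (refl , refl) | inj₁ (refl , refl) = refl
  ... | inj₂ (refl , refl) | inj₂ (refl , refl) = refl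

  count-samePairᵇ : ∀ e u → count (samePairᵇ e u) (allFin n) ≤ 1
  count-samePairᵇ e u = count≤1 (samePairᵇ e u) (samePairᵇ-partner e u)

  count-pairInᵇ : ∀ L u → count (pairInᵇ L u) (allFin n) ≤ length L
  count-pairInᵇ [] u = ≤-reflexive (count-false {f = pairInᵇ [] u} (λ _ → refl) (allFin n))
  count-pairInᵇ (e ∷ L) u =
    ≤-trans (count-∨ (samePairᵇ e u) (pairInᵇ L u) (allFin n)) (+-mono-≤ (count-samePairᵇ e u) (count-pairInᵇ L u))

  pairInᵇ-singleton : ∀ (L : List (Fin n × Fin n)) u v → length L ≤ 1 → pairInᵇ L u v ≡ true →
    ∃ λ e → L ≡ e ∷ [] × samePairᵇ e u v ≡ true
  pairInᵇ-singleton (e ∷ []) u v _ h with ∨-elim h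
  ... | inj₁ h₁ = e , refl , h₁
  pairInᵇ-singleton (_ ∷ _ ∷ _) u v (s≤s ()) _

  PairIn-singleton : ∀ (e : Fin n × Fin n) u v → PairIn (e ∷ []) u v ⇔ SamePair e u v
  PairIn-singleton e u v = mk⇔ (λ { (here p) → p }) here

  SamePair-swap : ∀ (a b : Fin n) u v → SamePair (a , b) u v ⇔ SamePair (b , a) u v
  SamePair-swap a b u v = mk⇔ swap swap
    where
    swap : ∀ {a b} → SamePair (a , b) u v → SamePair (b , a) u v
    swap (inj₁ (p , q)) = inj₂ (q , p)
    swap (inj₂ (p , q)) = inj₁ (q , p)

  new-pairs-irreflexive : ∀ (G : Graph n) L → NewPairs G L → ∀ u → pairInᵇ L u u ≡ false
  new-pairs-irreflexive G [] _ u = refl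
  new-pairs-irreflexive G ((a , b) ∷ L) ((a≢b , _) , new) u with a == u in au | b == u in bu
  ... | true | true = ⊥-elim (a≢b (trans (==-sound au) (sym (==-sound bu))))
  ... | true | false = new-pairs-irreflexive G L new u
  ... | false | _ = new-pairs-irreflexive G L new u

  pairs-are-edges : ∀ (G : Graph n) L → EdgesOf G L → ∀ u v → pairInᵇ L u v ≡ true → Edge G u v
  pairs-are-edges G ((a , b) ∷ L) (ab , edges) u v p with ∨-elim p
  ... | inj₂ p′ = pairs-are-edges G L edges u v p′
  ... | inj₁ p′ with samePairᵇ-sound (a , b) u v p′
  ...   | inj₁ (refl , refl) = ab
  ...   | inj₂ (refl , refl) = trans (Graph.sym G u v) ab

module _ {n : ℕ} where

  arrange-endpoints : ∀ (L : List (Fin n)) s t → multiplicity s L ≡ 1 → multiplicity t L ≡ 1 → s ≢ t →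
    (s ∷ (filterᵇ (λ w → not (w == s) ∧ not (w == t)) L ++ t ∷ [])) ≈ₘ L
  arrange-endpoints L s t s-once t-once s≢t f = begin
      ind (f s) + count f (middle ++ t ∷ [])
    ≡⟨ cong (ind (f s) +_) (trans (count-++ f middle (t ∷ [])) (+-comm (count f middle) _)) ⟩
      ind (f s) + ((ind (f t) + 0) + count f middle)
    ≡⟨ cong (λ c → ind (f s) + (ind (f t) + 0 + c)) (trans (count-filter _ f L) (count-cong reorder L)) ⟩
      ind (f s) + ((ind (f t) + 0) + count (λ w → (f w ∧ not (w == s)) ∧ not (w == t)) L)
    ≡⟨ cong (λ c → ind (f s) + (c + count (λ w → (f w ∧ not (w == s)) ∧ not (w == t)) L)) t-kept ⟩
      ind (f s) + (ind (f t ∧ not (t == s)) + count (λ w → (f w ∧ not (w == s)) ∧ not (w == t)) L)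
    ≡⟨ cong (ind (f s) +_) (sym (count-remove (λ w → f w ∧ not (w == s)) t L t-once)) ⟩
      ind (f s) + count (λ w → f w ∧ not (w == s)) L
    ≡⟨ sym (count-remove f s L s-once) ⟩
      count f L ∎
    where
    open ≡-Reasoning
    middle : List (Fin n)
    middle = filterᵇ (λ w → not (w == s) ∧ not (w == t)) L
    reorder : ∀ w → ((not (w == s) ∧ not (w == t)) ∧ f w) ≡ ((f w ∧ not (w == s)) ∧ not (w == t))
    reorder w = trans (∧-comm _ (f w)) (sym (∧-assoc (f w) _ _))
    t-kept : ind (f t) + 0 ≡ ind (f t ∧ not (t == s))
    t-kept = trans (+-identityʳ _) (cong ind (sym (trans (cong (λ b → f t ∧ not b) (==-≢ (≢-sym s≢t))) (∧-identityʳ (f t)))))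

  multiplicity-filter : ∀ (g : Fin n → Bool) s → multiplicity s (filterᵇ g (allFin n)) ≡ ind (g s)
  multiplicity-filter g s = trans (count-filter g (_== s) (allFin n)) (count-point g s (allFin n) (multiplicity-allFin s))

module ModifiedGraph {n : ℕ} (G : Graph n) (A B : List (Fin n × Fin n)) (B-irrefl : ∀ u → pairInᵇ B u u ≡ false) where

  adj : Fin n → Fin n → Bool
  adj = Graph.adj G

  adj′ : Fin n → Fin n → Bool
  adj′ u v = (adj u v ∧ not (pairInᵇ A u v)) ∨ pairInᵇ B u v

  adj′-sym : ∀ u v → adj′ u v ≡ adj′ v u
  adj′-sym u v rewrite Graph.sym G u v | pairInᵇ-sym A u v | pairInᵇ-sym B u v = refl

  adj′-irrefl : ∀ u → adj′ u u ≡ false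
  adj′-irrefl u rewrite Graph.irrefl G u | B-irrefl u = refl

  Adj′ : Fin n → Fin n → Set
  Adj′ a b = adj′ a b ≡ true

  adj′⇒Modified : ∀ {u v} → Adj′ u v → Modified G A B u v
  adj′⇒Modified {u} {v} h with pairInᵇ B u v in inB
  ... | true = inj₂ (pairInᵇ-sound B u v inB)
  ... | false = inj₁ (∧-projˡ kept , λ p → true≢false (pairInᵇ-complete A u v p) (not-true (∧-projʳ {adj u v} kept)))
    where
    kept : (adj u v ∧ not (pairInᵇ A u v)) ≡ true
    kept = trans (sym (∨-identityʳ _)) h

  new-pair-adj′ : ∀ u v → pairInᵇ B u v ≡ true → Adj′ u v
  new-pair-adj′ u v = ∨-introʳ _

  kept-edge-adj′ : ∀ u v → adj u v ≡ true → pairInᵇ A u v ≡ false → Adj′ u v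
  kept-edge-adj′ u v uv kept = ∨-introˡ _ (∧-intro uv (not-false kept))

  non-adj′ : ∀ u v → adj′ u v ≡ false → adj u v ≡ false ⊎ pairInᵇ A u v ≡ true
  non-adj′ u v h with adj u v | pairInᵇ A u v
  ... | false | _ = inj₁ refl
  ... | true | true = inj₂ refl
  ... | true | false = ⊥-elim (true≢false refl h)

  block-non-neighbours : ∀ (block missing : Fin n → Bool) p → (∀ w → block w ≡ true → adj p w ≡ false → missing w ≡ true) →
    count (λ w → block w ∧ not (adj′ p w)) (allFin n) ≤ count missing (allFin n) + length A
  block-non-neighbours block missing p covered =
    ≤-trans (count-mono missing-or-removed (allFin n))
      (≤-trans (count-∨ missing (pairInᵇ A p) (allFin n)) (+-monoʳ-≤ (count missing (allFin n)) (count-pairInᵇ A p)))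
    where
    missing-or-removed : ∀ w → (block w ∧ not (adj′ p w)) ≡ true → (missing w ∨ pairInᵇ A p w) ≡ true
    missing-or-removed w e with non-adj′ p w (not-true (∧-projʳ {block w} e))
    ... | inj₁ no-edge = ∨-introˡ _ (covered w (∧-projˡ e) no-edge)
    ... | inj₂ removed = ∨-introʳ (missing w) removed

  clique-non-neighbours : ∀ (block : Fin n → Bool) p → (∀ w → block w ≡ true → adj p w ≡ false → w ≡ p) →
    count (λ w → block w ∧ not (adj′ p w)) (allFin n) ≤ 1 + length A
  clique-non-neighbours block p clique =
    subst (λ c → count (λ w → block w ∧ not (adj′ p w)) (allFin n) ≤ c + length A) (multiplicity-allFin p)
      (block-non-neighbours block (_== p) p (λ w bw no-edge → subst (λ v → (w == v) ≡ true) (clique w bw no-edge) (==-refl w)))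

  cycle⇒hamiltonian : 3 ≤ n → ∀ s t → Chain Adj′ s t → Adj′ (last s t) s → (s ∷ t) ≈ₘ allFin n → Hamiltonian (Modified G A B)
  cycle⇒hamiltonian 3≤n s t chain closing all =
    let 3≤n , f , bij , steps = hamiltonian-from-cycle Adj′ s t 3≤n chain closing all in
    3≤n , f , bij , λ i → adj′⇒Modified (steps i)

  two-paths⇒hamiltonian : 3 ≤ n → ∀ (g : Fin n → Bool) s₁ t₁ s₂ t₂ → Chain Adj′ s₁ t₁ → Chain Adj′ s₂ t₂ →
    Adj′ (last s₁ t₁) s₂ → Adj′ (last s₂ t₂) s₁ →
    (s₁ ∷ t₁) ≈ₘ filterᵇ g (allFin n) → (s₂ ∷ t₂) ≈ₘ filterᵇ (λ w → not (g w)) (allFin n) → Hamiltonian (Modified G A B)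
  two-paths⇒hamiltonian 3≤n g s₁ t₁ s₂ t₂ c₁ c₂ join₁ join₂ all₁ all₂ =
    cycle⇒hamiltonian 3≤n s₁ (t₁ ++ s₂ ∷ t₂) (chain-++ c₁ (join₁ ∷ c₂)) (subst (λ z → Adj′ z s₁) (sym (last-++ s₁ t₁ (s₂ ∷ t₂))) join₂) all
    where
    all : (s₁ ∷ (t₁ ++ s₂ ∷ t₂)) ≈ₘ allFin n
    all f = begin
        count f (s₁ ∷ t₁ ++ s₂ ∷ t₂)
      ≡⟨ count-++ f (s₁ ∷ t₁) (s₂ ∷ t₂) ⟩
        count f (s₁ ∷ t₁) + count f (s₂ ∷ t₂)
      ≡⟨ cong₂ _+_ (trans (all₁ f) (count-filter g f (allFin n))) (trans (all₂ f) (count-filter _ f (allFin n))) ⟩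
        count (λ w → g w ∧ f w) (allFin n) + count (λ w → not (g w) ∧ f w) (allFin n)
      ≡⟨ cong₂ _+_ (count-cong (λ w → ∧-comm (g w) (f w)) (allFin n)) (count-cong (λ w → ∧-comm (not (g w)) (f w)) (allFin n)) ⟩
        count (λ w → f w ∧ g w) (allFin n) + count (λ w → f w ∧ not (g w)) (allFin n)
      ≡⟨ sym (count-split f g (allFin n)) ⟩
        count f (allFin n) ∎
      where open ≡-Reasoning

  private
    module Unconstrained = BreakElimination adj′ adj′-sym adj′-irrefl (λ _ _ → ⊤) (λ _ → tt) (λ _ → tt)
    module DenseExchanges = Exchanges adj′ adj′-sym adj′-irrefl (λ _ _ → ⊤) (λ _ → tt) (λ _ → tt) _==_ ==-refl

  Dense : (Fin n → Bool) → ℕ → Set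
  Dense g d = 3 + (d + d) ≤ count g (allFin n) × (∀ p → g p ≡ true → count (λ w → g w ∧ not (adj′ p w)) (allFin n) ≤ suc d)

  dense-block-path : (d : ℕ) (g : Fin n → Bool) (s t : Fin n) → g s ≡ true → g t ≡ true → s ≢ t → Dense g d →
    ∃ λ path → Chain Adj′ s path × (s ∷ path) ≈ₘ filterᵇ g (allFin n) × last s path ≡ t
  dense-block-path d g s t gs gt s≢t (large , sparse) =
    Unconstrained.eliminate-breaks s L t exchanges initial (trivial-chain s initial)
      (arrange-endpoints L s t (trans (multiplicity-filter g s) (cong ind gs)) (trans (multiplicity-filter g t) (cong ind gt)) s≢t)
      (last-++ s (filterᵇ (λ w → not (w == s) ∧ not (w == t)) L) (t ∷ []))
    where
    L initial : List (Fin n)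
    L = filterᵇ g (allFin n)
    initial = filterᵇ (λ w → not (w == s) ∧ not (w == t)) L ++ t ∷ []
    sparse′ : ∀ p → 1 ≤ count (_== p) L → count (λ w → not (adj′ p w)) L ≤ suc d
    sparse′ p occurs with g p in gp
    ... | true = subst (_≤ suc d) (sym (count-filter g _ (allFin n))) (sparse p gp)
    ... | false = ⊥-elim (<-irrefl refl (subst (0 <_) (trans (multiplicity-filter g p) (cong ind gp)) occurs))
    exchanges : Unconstrained.ExchangeCondition s L t
    exchanges = DenseExchanges.dense⇒exchanges d s L t (subst (3 + (d + d) ≤_) (sym (length-filter g (allFin n))) large) sparse′

module Partitioned (k : ℕ) (6≤k : 6 ≤ k) {n : ℕ} (G : Graph n) (V₁ V₂ : Subset n) (A B : List (Fin n × Fin n))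
    (new : NewPairs G B) where

  open ModifiedGraph G A B (new-pairs-irreflexive G B new) public

  vertices : List (Fin n)
  vertices = allFin n

  in₁ : Fin n → Bool
  in₁ = lookup V₁

  out₁ : Fin n → Bool
  out₁ w = not (in₁ w)

  3≤k : 3 ≤ k
  3≤k = ≤-trans (s≤s (s≤s (s≤s z≤n))) 6≤k

  5≤k : 5 ≤ k
  5≤k = ≤-trans (s≤s (s≤s (s≤s (s≤s (s≤s z≤n))))) 6≤k

  3≤2k+ : ∀ c → 3 ≤ 2 * k + c
  3≤2k+ c = ≤-trans 3≤k (≤-trans (m≤m+n k (k + 0)) (m≤m+n (2 * k) c))

  size-V₁ : count in₁ vertices ≡ ∣ V₁ ∣
  size-V₁ = sym (∣∣≡count V₁)

  size-outside : ∀ m → n ≡ ∣ V₁ ∣ + m → count out₁ vertices ≡ m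
  size-outside m n≡ = +-cancelˡ-≡ (count in₁ vertices) _ _
    (trans (sym (count-split (λ _ → true) in₁ vertices))
      (trans (count-true vertices) (trans (length-tabulate (λ i → i)) (trans n≡ (cong (_+ m) (sym size-V₁))))))

  outside⇒∈V₂ : Covers k G V₁ V₂ → ∀ {w} → out₁ w ≡ true → w ∈ V₂
  outside⇒∈V₂ cover {w} out with cover w
  ... | inj₁ w∈V₁ = ⊥-elim (true≢false (∈⇒lookup w∈V₁) (not-true out))
  ... | inj₂ w∈V₂ = w∈V₂

  ∈V₂⇒outside : Disjoint k G V₁ V₂ → ∀ {w} → w ∈ V₂ → out₁ w ≡ true
  ∈V₂⇒outside disjoint {w} w∈V₂ with in₁ w in e
  ... | true = ⊥-elim (disjoint w (lookup⇒∈ e) w∈V₂)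
  ... | false = refl

  ∈V₂-x₀⇒outside : ∀ {x₀} → MeetIn k G V₁ V₂ x₀ → ∀ {w} → w ∈ V₂ → w ≢ x₀ → out₁ w ≡ true
  ∈V₂-x₀⇒outside (_ , _ , only-x₀) {w} w∈V₂ w≢x₀ with in₁ w in e
  ... | true = ⊥-elim (w≢x₀ (only-x₀ w (lookup⇒∈ e) w∈V₂))
  ... | false = refl

  outside-≢ : ∀ {u w} → in₁ u ≡ true → out₁ w ≡ true → u ≢ w
  outside-≢ u-in w-out refl = true≢false u-in (not-true w-out)

  clique-miss : ∀ {S} → CompleteOn k G V₁ V₂ S → ∀ {p w} → p ∈ S → w ∈ S → adj p w ≡ false → w ≡ p
  clique-miss complete {p} {w} p∈S w∈S no-edge with w ≟ p
  ... | yes w≡p = w≡p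
  ... | no w≢p = ⊥-elim (true≢false (complete p w p∈S w∈S (≢-sym w≢p)) no-edge)

  only-pair-adj′ : ∀ e → B ≡ e ∷ [] → ∀ u v → SamePair e u v → Adj′ u v
  only-pair-adj′ e B≡ u v same = new-pair-adj′ u v (subst (λ L → pairInᵇ L u v ≡ true) (sym B≡) (∨-introˡ _ (samePairᵇ-complete e u v same)))

  first-pair-adj′ : ∀ e e′ → B ≡ e ∷ e′ ∷ [] → ∀ u v → SamePair e u v → Adj′ u v
  first-pair-adj′ e e′ B≡ u v same = new-pair-adj′ u v (subst (λ L → pairInᵇ L u v ≡ true) (sym B≡) (∨-introˡ _ (samePairᵇ-complete e u v same)))

  second-pair-adj′ : ∀ e e′ → B ≡ e ∷ e′ ∷ [] → ∀ u v → SamePair e′ u v → Adj′ u v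
  second-pair-adj′ e e′ B≡ u v same = new-pair-adj′ u v
    (subst (λ L → pairInᵇ L u v ≡ true) (sym B≡) (∨-introʳ (samePairᵇ e u v) (∨-introˡ _ (samePairᵇ-complete e′ u v same))))

  two-dense-blocks : 3 ≤ n → ∀ s₁ t₁ s₂ t₂ → in₁ s₁ ≡ true → in₁ t₁ ≡ true → s₁ ≢ t₁ →
    out₁ s₂ ≡ true → out₁ t₂ ≡ true → s₂ ≢ t₂ → Adj′ t₁ s₂ → Adj′ t₂ s₁ →
    ∀ d₁ → Dense in₁ d₁ → ∀ d₂ → Dense out₁ d₂ →
    Hamiltonian (Modified G A B)
  two-dense-blocks 3≤n s₁ t₁ s₂ t₂ s₁-in t₁-in s₁≢t₁ s₂-out t₂-out s₂≢t₂ t₁s₂ t₂s₁ d₁ dense₁ d₂ dense₂ =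
    let path₁ , chain₁ , all₁ , end₁ = dense-block-path d₁ in₁ s₁ t₁ s₁-in t₁-in s₁≢t₁ dense₁
        path₂ , chain₂ , all₂ , end₂ = dense-block-path d₂ out₁ s₂ t₂ s₂-out t₂-out s₂≢t₂ dense₂
    in two-paths⇒hamiltonian 3≤n in₁ s₁ path₁ s₂ path₂ chain₁ chain₂
         (subst (λ z → Adj′ z s₂) (sym end₁) t₁s₂) (subst (λ z → Adj′ z s₁) (sym end₂) t₂s₁) all₁ all₂

  clique-bound : ∀ {S} (block : Fin n → Bool) → CompleteOn k G V₁ V₂ S → (∀ {w} → block w ≡ true → w ∈ S) →
    ∀ {d} → length A ≤ d → ∀ p → block p ≡ true → count (λ w → block w ∧ not (adj′ p w)) vertices ≤ suc d
  clique-bound block complete ⊆S A≤d p bp =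
    ≤-trans (clique-non-neighbours block p (λ w bw → clique-miss complete (⊆S bp) (⊆S bw))) (s≤s A≤d)

  through-x₀ : 3 ≤ n → ∀ x₀ x₁ x₂ y → B ≡ (x₁ , x₂) ∷ [] → in₁ x₀ ≡ true → in₁ x₁ ≡ true → x₀ ≢ x₁ →
    out₁ x₂ ≡ true → out₁ y ≡ true → x₂ ≢ y → adj x₀ y ≡ true → pairInᵇ A x₀ y ≡ false →
    ∀ d₁ → Dense in₁ d₁ → ∀ d₂ → Dense out₁ d₂ →
    Hamiltonian (Modified G A B)
  through-x₀ 3≤n x₀ x₁ x₂ y B≡ x₀-in x₁-in x₀≢x₁ x₂-out y-out x₂≢y x₀y kept =
    two-dense-blocks 3≤n x₀ x₁ x₂ y x₀-in x₁-in x₀≢x₁ x₂-out y-out x₂≢y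
      (only-pair-adj′ _ B≡ x₁ x₂ (inj₁ (refl , refl)))
      (kept-edge-adj′ y x₀ (trans (Graph.sym G y x₀) x₀y) (trans (pairInᵇ-sym A y x₀) kept))

  case-G1 : IsG1 k G V₁ V₂ → length A ≤ 2 → ∀ a₁ b₁ a₂ b₂ → B ≡ (a₁ , b₁) ∷ (a₂ , b₂) ∷ [] →
    a₁ ∈ V₁ → b₁ ∈ V₂ → a₂ ∈ V₁ → b₂ ∈ V₂ → a₁ ≢ a₂ → b₁ ≢ b₂ → Hamiltonian (Modified G A B)
  case-G1 (n≡ , cover , disjoint , ∣V₁∣≡ , _ , complete₁ , complete₂ , _) A≤2 a₁ b₁ a₂ b₂ B≡ a₁∈ b₁∈ a₂∈ b₂∈ a₁≢a₂ b₁≢b₂ =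
    two-dense-blocks (subst (3 ≤_) (sym n≡) (3≤2k+ 2)) a₁ a₂ b₂ b₁ (∈⇒lookup a₁∈) (∈⇒lookup a₂∈) a₁≢a₂
      (∈V₂⇒outside disjoint b₂∈) (∈V₂⇒outside disjoint b₁∈) (≢-sym b₁≢b₂)
      (second-pair-adj′ _ _ B≡ a₂ b₂ (inj₁ (refl , refl))) (first-pair-adj′ _ _ B≡ b₁ a₁ (inj₂ (refl , refl)))
      2 (subst (7 ≤_) (sym (trans size-V₁ ∣V₁∣≡)) 7≤k+1 , clique-bound in₁ complete₁ lookup⇒∈ A≤2)
      2 (subst (7 ≤_) (sym (size-outside (k + 1) (trans n≡ (sym (trans (cong (_+ (k + 1)) ∣V₁∣≡) (2k+2 k)))))) 7≤k+1 ,
         clique-bound out₁ complete₂ (outside⇒∈V₂ cover) A≤2)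
    where
    7≤k+1 : 7 ≤ k + 1
    7≤k+1 = subst (7 ≤_) (+-comm 1 k) (s≤s 6≤k)
    2k+2 : ∀ k → k + 1 + (k + 1) ≡ 2 * k + 2
    2k+2 = solve-∀

  case-G2 : ∀ x₀ → IsG2 k G V₁ V₂ x₀ → length A ≤ 1 → ∀ x₁ x₂ → B ≡ (x₁ , x₂) ∷ [] →
    x₁ ∈ V₁ → x₁ ≢ x₀ → x₂ ∈ V₂ → x₂ ≢ x₀ → Hamiltonian (Modified G A B)
  case-G2 x₀ (n≡ , cover , meet@(x₀∈V₁ , x₀∈V₂ , _) , ∣V₁∣≡ , _ , edges) A≤1 x₁ x₂ B≡ x₁∈ x₁≢x₀ x₂∈ x₂≢x₀ =
    via (count-witness _ vertices candidates)
    where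
    size₂ : count out₁ vertices ≡ k
    size₂ = size-outside k (trans n≡ (sym (trans (cong (_+ k) ∣V₁∣≡) (2k+1 k))))
      where
      2k+1 : ∀ k → k + 1 + k ≡ 2 * k + 1
      2k+1 = solve-∀
    x₂-out : out₁ x₂ ≡ true
    x₂-out = ∈V₂-x₀⇒outside meet x₂∈ x₂≢x₀
    complete₁ : CompleteOn k G V₁ V₂ V₁
    complete₁ u v u∈ v∈ u≢v = Equivalence.from (edges u v) (u≢v , inj₁ (u∈ , v∈))
    complete₂ : CompleteOn k G V₁ V₂ V₂
    complete₂ u v u∈ v∈ u≢v = Equivalence.from (edges u v) (u≢v , inj₂ (u∈ , v∈))
    candidates : 1 ≤ count (λ w → out₁ w ∧ (not (w == x₂) ∧ not (pairInᵇ A x₀ w))) vertices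
    candidates = +-cancelˡ-≤ 2 _ _ (≤-trans (subst (3 ≤_) (sym size₂) 3≤k)
      (≤-trans (count-avoiding out₁ (_== x₂) (pairInᵇ A x₀) vertices)
        (+-monoˡ-≤ _ (+-mono-≤ (≤-reflexive (multiplicity-allFin x₂)) (≤-trans (count-pairInᵇ A x₀) A≤1)))))
    via : ∃ (λ y → (out₁ y ∧ (not (y == x₂) ∧ not (pairInᵇ A x₀ y))) ≡ true) → Hamiltonian (Modified G A B)
    via (y , found) =
      through-x₀ (subst (3 ≤_) (sym n≡) (3≤2k+ 1)) x₀ x₁ x₂ y B≡ (∈⇒lookup x₀∈V₁) (∈⇒lookup x₁∈) (≢-sym x₁≢x₀)
        x₂-out y-out (≢-sym y≢x₂)
        (Equivalence.from (edges x₀ y) (outside-≢ (∈⇒lookup x₀∈V₁) y-out , inj₂ (x₀∈V₂ , outside⇒∈V₂ cover y-out)))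
        (not-true (∧-projʳ {not (y == x₂)} (∧-projʳ {out₁ y} found)))
        1 (subst (5 ≤_) (sym (trans size-V₁ ∣V₁∣≡)) (≤-trans 5≤k (m≤m+n k 1)) , clique-bound in₁ complete₁ lookup⇒∈ A≤1)
        1 (subst (5 ≤_) (sym size₂) 5≤k , clique-bound out₁ complete₂ (outside⇒∈V₂ cover) A≤1)
      where
      y-out : out₁ y ≡ true
      y-out = ∧-projˡ found
      y≢x₂ : y ≢ x₂
      y≢x₂ refl = true≢false (==-refl y) (not-true (∧-projˡ (∧-projʳ {out₁ y} found)))

module ClassG3 (k : ℕ) (6≤k : 6 ≤ k) {n : ℕ} (G : Graph n) (V₁ V₂ : Subset n) (A B : List (Fin n × Fin n))
    (new : NewPairs G B) (x₀ : Fin n) (n≡ : n ≡ 2 * k + 2) (cover : Covers k G V₁ V₂) (meet : MeetIn k G V₁ V₂ x₀)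
    (∣V₁∣≡ : ∣ V₁ ∣ ≡ k + 1) (∣V₂∣≡ : ∣ V₂ ∣ ≡ k + 2) (complete₁ : CompleteOn k G V₁ V₂ V₁)
    (inside : ∀ u v → Edge G u v → (u ∈ V₁ × v ∈ V₁) ⊎ (u ∈ V₂ × v ∈ V₂))
    (two-connected : TwoConnectedOn G V₂) (min-deg : MinDeg k G V₁ V₂) where

  open Partitioned k 6≤k G V₁ V₂ A B new

  isG3 : IsG3 k G V₁ V₂ x₀
  isG3 = n≡ , cover , meet , ∣V₁∣≡ , ∣V₂∣≡ , complete₁ , inside , two-connected , min-deg

  x₀∈V₁ : x₀ ∈ V₁
  x₀∈V₁ = proj₁ meet

  x₀∈V₂ : x₀ ∈ V₂
  x₀∈V₂ = proj₁ (proj₂ meet)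

  x₀-in : in₁ x₀ ≡ true
  x₀-in = ∈⇒lookup x₀∈V₁

  outside-count : count out₁ vertices ≡ k + 1
  outside-count = size-outside (k + 1) (trans n≡ (sym (trans (cong (_+ (k + 1)) ∣V₁∣≡) (2k+2 k))))
    where
    2k+2 : ∀ k → k + 1 + (k + 1) ≡ 2 * k + 2
    2k+2 = solve-∀

  -- A vertex outside V₁ has all its ≥ k neighbours in V₂, which has k + 2 vertices.
  missing-in-V₂ : ∀ p → out₁ p ≡ true → count (λ w → lookup V₂ w ∧ not (adj p w)) vertices ≤ 2
  missing-in-V₂ p p-out = +-cancelˡ-≤ k _ _ (begin
      k + count (λ w → lookup V₂ w ∧ not (adj p w)) vertices
    ≤⟨ +-monoˡ-≤ _ (≤-trans (subst (k ≤_) (deg≡count G p) (min-deg p)) (count-mono neighbour-in-V₂ vertices)) ⟩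
      count (λ w → lookup V₂ w ∧ adj p w) vertices + count (λ w → lookup V₂ w ∧ not (adj p w)) vertices
    ≡⟨ sym (count-split (lookup V₂) (adj p) vertices) ⟩
      count (lookup V₂) vertices
    ≡⟨ trans (sym (∣∣≡count V₂)) ∣V₂∣≡ ⟩
      k + 2 ∎)
    where
    open ≤-Reasoning
    neighbour-in-V₂ : ∀ w → adj p w ≡ true → (lookup V₂ w ∧ adj p w) ≡ true
    neighbour-in-V₂ w pw with inside p w pw
    ... | inj₁ (p∈V₁ , _) = ⊥-elim (true≢false (∈⇒lookup p∈V₁) (not-true p-out))
    ... | inj₂ (_ , w∈V₂) = ∧-intro (∈⇒lookup w∈V₂) pw

  V₂-x₀⇒outside : ∀ {w} → w ∈ V₂ → w ≢ x₀ → out₁ w ≡ true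
  V₂-x₀⇒outside = ∈V₂-x₀⇒outside meet

  module NoSurvivingEdge (A≤1 : length A ≤ 1) (x₁ x₂ : Fin n) (B≡ : B ≡ (x₁ , x₂) ∷ [])
      (x₁∈ : x₁ ∈ V₁) (x₁≢x₀ : x₁ ≢ x₀) (x₂∈ : x₂ ∈ V₂) (x₂≢x₀ : x₂ ≢ x₀)
      (removed : ∀ w → out₁ w ≡ true → w ≢ x₂ → adj x₀ w ≡ true → pairInᵇ A x₀ w ≡ true) where

    connected-minus : ∀ w → w ∈ V₂ → ConnectedOn G (V₂ - w)
    connected-minus = proj₂ (proj₂ two-connected)

    removed′ : ∀ w → w ∈ V₂ → w ≢ x₀ → w ≢ x₂ → adj x₀ w ≡ true → pairInᵇ A x₀ w ≡ true
    removed′ w w∈ w≢x₀ = removed w (V₂-x₀⇒outside w∈ w≢x₀)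

    outside-other-than-x₂ : 1 ≤ count (λ w → out₁ w ∧ not (w == x₂)) vertices
    outside-other-than-x₂ = +-cancelˡ-≤ 1 _ _ (≤-trans (subst (2 ≤_) (sym outside-count) (+-mono-≤ (≤-trans (s≤s z≤n) 3≤k) ≤-refl))
      (≤-trans (≤-reflexive (count-remove out₁ x₂ vertices (multiplicity-allFin x₂))) (+-monoˡ-≤ _ (ind≤1 (out₁ x₂)))))

    second-neighbour : ∃ λ y₂ → y₂ ∈ V₂ × y₂ ≢ x₂ × adj x₀ y₂ ≡ true
    second-neighbour with count-witness _ vertices outside-other-than-x₂
    ... | v , found with walk-first-step G (connected-minus x₂ x₂∈ x₀ v (x∈p∧x≢y⇒x∈p-y x₀∈V₂ (≢-sym x₂≢x₀))
                           (x∈p∧x≢y⇒x∈p-y (outside⇒∈V₂ cover (∧-projˡ found)) v≢x₂)) (outside-≢ x₀-in (∧-projˡ found))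
      where
      v≢x₂ : v ≢ x₂
      v≢x₂ refl = true≢false (==-refl x₂) (not-true (∧-projʳ {out₁ v} found))
    ...   | y , y∈ , x₀y = y , x∈p-y⇒x∈p y∈ , x∈p-y⇒x≢y y∈ , x₀y

    module _ (y₂ : Fin n) (y₂∈ : y₂ ∈ V₂) (y₂≢x₂ : y₂ ≢ x₂) (x₀y₂ : adj x₀ y₂ ≡ true)
        (e₀ : Fin n × Fin n) (A≡ : A ≡ e₀ ∷ []) (e₀≈x₀y₂ : samePairᵇ e₀ x₀ y₂ ≡ true) where

      x₀≢y₂ : x₀ ≢ y₂
      x₀≢y₂ = edge-≢ G x₀y₂

      only-removed : ∀ w → pairInᵇ A x₀ w ≡ true → w ≡ y₂
      only-removed w x₀w = sym (samePairᵇ-partner e₀ x₀ y₂ w e₀≈x₀y₂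
        (trans (sym (∨-identityʳ _)) (subst (λ L → pairInᵇ L x₀ w ≡ true) A≡ x₀w)))

      x₀x₂ : adj x₀ x₂ ≡ true
      x₀x₂ with adj x₀ x₂ in no-edge
      ... | true = refl
      ... | false with walk-first-step G (connected-minus y₂ y₂∈ x₀ x₂ (x∈p∧x≢y⇒x∈p-y x₀∈V₂ x₀≢y₂) (x∈p∧x≢y⇒x∈p-y x₂∈ (≢-sym y₂≢x₂))) (≢-sym x₂≢x₀)
      ...   | y₃ , y₃∈ , x₀y₃ with y₃ ≟ x₂
      ...     | yes refl = ⊥-elim (true≢false x₀y₃ no-edge)
      ...     | no y₃≢x₂ = ⊥-elim (x∈p-y⇒x≢y y₃∈ (only-removed y₃
                  (removed′ y₃ (x∈p-y⇒x∈p y₃∈) (≢-sym (edge-≢ G x₀y₃)) y₃≢x₂ x₀y₃)))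

      neighbours : ∀ w → w ∈ V₂ → Edge G x₀ w ⇔ (w ≡ x₂ ⊎ w ≡ y₂)
      neighbours w w∈ = mk⇔ to from
        where
        to : Edge G x₀ w → w ≡ x₂ ⊎ w ≡ y₂
        to x₀w with w ≟ x₂
        ... | yes w≡x₂ = inj₁ w≡x₂
        ... | no w≢x₂ = inj₂ (only-removed w (removed′ w w∈ (≢-sym (edge-≢ G x₀w)) w≢x₂ x₀w))
        from : w ≡ x₂ ⊎ w ≡ y₂ → Edge G x₀ w
        from (inj₁ refl) = x₀x₂
        from (inj₂ refl) = x₀y₂

      -- Such a u already misses itself and x₀ inside V₂, and it may miss at most two vertices there.
      adjacent-off-x₂y₂ : ∀ u w → u ∈ V₂ - x₀ → w ∈ V₂ - x₀ → u ≢ x₂ → u ≢ y₂ → u ≢ w → Edge G u w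
      adjacent-off-x₂y₂ u w u∈ w∈ u≢x₂ u≢y₂ u≢w with adj u w in no-edge
      ... | true = refl
      ... | false = ⊥-elim (<-irrefl refl (≤-trans three-missing (missing-in-V₂ u (V₂-x₀⇒outside (x∈p-y⇒x∈p u∈) (x∈p-y⇒x≢y u∈)))))
        where
        u≁x₀ : adj u x₀ ≡ false
        u≁x₀ with adj u x₀ in ux₀
        ... | false = refl
        ... | true with Equivalence.to (neighbours u (x∈p-y⇒x∈p u∈)) (trans (Graph.sym G x₀ u) ux₀)
        ...   | inj₁ u≡x₂ = ⊥-elim (u≢x₂ u≡x₂)
        ...   | inj₂ u≡y₂ = ⊥-elim (u≢y₂ u≡y₂)
        three-missing : 3 ≤ count (λ v → lookup V₂ v ∧ not (adj u v)) vertices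
        three-missing = count≥3 _ u x₀ w (∧-intro (∈⇒lookup (x∈p-y⇒x∈p u∈)) (not-false (Graph.irrefl G u)))
          (∧-intro (∈⇒lookup x₀∈V₂) (not-false u≁x₀)) (∧-intro (∈⇒lookup (x∈p-y⇒x∈p w∈)) (not-false no-edge))
          (x∈p-y⇒x≢y u∈) u≢w (≢-sym (x∈p-y⇒x≢y w∈))

      almost-complete : ∀ u w → u ∈ V₂ - x₀ → w ∈ V₂ - x₀ → u ≢ w → ¬ SamePair (x₂ , y₂) u w → Edge G u w
      almost-complete u w u∈ w∈ u≢w not-x₂y₂ with u ≟ x₂ | u ≟ y₂ | w ≟ x₂ | w ≟ y₂
      ... | no u≢x₂ | no u≢y₂ | _ | _ = adjacent-off-x₂y₂ u w u∈ w∈ u≢x₂ u≢y₂ u≢w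
      ... | _ | _ | no w≢x₂ | no w≢y₂ = trans (Graph.sym G u w) (adjacent-off-x₂y₂ w u w∈ u∈ w≢x₂ w≢y₂ (≢-sym u≢w))
      ... | yes refl | _ | yes refl | _ = ⊥-elim (u≢w refl)
      ... | yes refl | _ | _ | yes refl = ⊥-elim (not-x₂y₂ (inj₁ (refl , refl)))
      ... | _ | yes refl | yes refl | _ = ⊥-elim (not-x₂y₂ (inj₂ (refl , refl)))
      ... | _ | yes refl | _ | yes refl = ⊥-elim (u≢w refl)

      configuration : Exceptional k G V₁ V₂ A B
      configuration = x₀ , x₁ , x₂ , y₂ , isG3 , x₁∈ , x₁≢x₀ , x₂∈ , x₂≢x₀ , y₂∈ , ≢-sym y₂≢x₂ , neighbours ,
        (λ u w → subst (λ L → PairIn L u w ⇔ SamePair (x₀ , y₂) u w) (sym A≡) (removed-pair u w e₀ (samePairᵇ-sound e₀ x₀ y₂ e₀≈x₀y₂))) ,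
        (λ u w → subst (λ L → PairIn L u w ⇔ SamePair (x₁ , x₂) u w) (sym B≡) (PairIn-singleton (x₁ , x₂) u w)) ,
        almost-complete
        where
        removed-pair : ∀ u w e → SamePair e x₀ y₂ → PairIn (e ∷ []) u w ⇔ SamePair (x₀ , y₂) u w
        removed-pair u w (a , b) (inj₁ (refl , refl)) = PairIn-singleton (a , b) u w
        removed-pair u w (a , b) (inj₂ (refl , refl)) = mk⇔
          (λ p → Equivalence.to (SamePair-swap a b u w) (Equivalence.to (PairIn-singleton (a , b) u w) p))
          (λ p → Equivalence.from (PairIn-singleton (a , b) u w) (Equivalence.from (SamePair-swap a b u w) p))

    exceptional : Exceptional k G V₁ V₂ A B
    exceptional with second-neighbour
    ... | y₂ , y₂∈ , y₂≢x₂ , x₀y₂ with pairInᵇ-singleton A x₀ y₂ A≤1 (removed′ y₂ y₂∈ (≢-sym (edge-≢ G x₀y₂)) y₂≢x₂ x₀y₂)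
    ...   | e₀ , A≡ , e₀≈x₀y₂ = configuration y₂ y₂∈ y₂≢x₂ x₀y₂ e₀ A≡ e₀≈x₀y₂

  case-G3 : length A ≤ 1 → ∀ x₁ x₂ → B ≡ (x₁ , x₂) ∷ [] → x₁ ∈ V₁ → x₁ ≢ x₀ → x₂ ∈ V₂ → x₂ ≢ x₀ →
    ¬ Exceptional k G V₁ V₂ A B → Hamiltonian (Modified G A B)
  case-G3 A≤1 x₁ x₂ B≡ x₁∈ x₁≢x₀ x₂∈ x₂≢x₀ not-exceptional
    with count (λ w → out₁ w ∧ (not (w == x₂) ∧ (adj x₀ w ∧ not (pairInᵇ A x₀ w)))) vertices in survivors
  ... | zero = ⊥-elim (not-exceptional (NoSurvivingEdge.exceptional A≤1 x₁ x₂ B≡ x₁∈ x₁≢x₀ x₂∈ x₂≢x₀ removed))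
    where
    removed : ∀ w → out₁ w ≡ true → w ≢ x₂ → adj x₀ w ≡ true → pairInᵇ A x₀ w ≡ true
    removed w w-out w≢x₂ x₀w with pairInᵇ A x₀ w in x₀w-removed
    ... | true = refl
    ... | false = ⊥-elim (true≢false (∧-intro w-out (∧-intro (not-false (==-≢ w≢x₂)) (∧-intro x₀w (not-false x₀w-removed))))
                                     (count≡0 _ w survivors))
  ... | suc _ with count-witness _ vertices (subst (1 ≤_) (sym survivors) (s≤s z≤n))
  ...   | y , found =
    through-x₀ (subst (3 ≤_) (sym n≡) (3≤2k+ 2)) x₀ x₁ x₂ y B≡ x₀-in (∈⇒lookup x₁∈) (≢-sym x₁≢x₀)
      (V₂-x₀⇒outside x₂∈ x₂≢x₀) (∧-projˡ found) (≢-sym y≢x₂) (∧-projˡ x₀y-kept) (not-true (∧-projʳ {adj x₀ y} x₀y-kept))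
      1 (subst (5 ≤_) (sym (trans size-V₁ ∣V₁∣≡)) (≤-trans 5≤k (m≤m+n k 1)) , clique-bound in₁ complete₁ lookup⇒∈ A≤1)
      2 (subst (7 ≤_) (sym outside-count) (subst (7 ≤_) (+-comm 1 k) (s≤s 6≤k)) , sparse₂)
    where
    rest : (not (y == x₂) ∧ (adj x₀ y ∧ not (pairInᵇ A x₀ y))) ≡ true
    rest = ∧-projʳ {out₁ y} found
    y≢x₂ : y ≢ x₂
    y≢x₂ refl = true≢false (==-refl y) (not-true (∧-projˡ rest))
    x₀y-kept : (adj x₀ y ∧ not (pairInᵇ A x₀ y)) ≡ true
    x₀y-kept = ∧-projʳ {not (y == x₂)} rest
    sparse₂ : ∀ p → out₁ p ≡ true → count (λ w → out₁ w ∧ not (adj′ p w)) vertices ≤ 3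
    sparse₂ p p-out = ≤-trans (block-non-neighbours out₁ (λ w → lookup V₂ w ∧ not (adj p w)) p
                                (λ w w-out no-edge → ∧-intro (∈⇒lookup (outside⇒∈V₂ cover w-out)) (not-false no-edge)))
                              (+-mono-≤ (missing-in-V₂ p p-out) A≤1)

filterᵇ-all : ∀ {A : Set} (g : A → Bool) xs → All (λ x → g x ≡ true) (filterᵇ g xs)
filterᵇ-all g [] = []
filterᵇ-all g (x ∷ xs) with g x in gx
... | true = gx ∷ filterᵇ-all g xs
... | false = filterᵇ-all g xs

interleave : ∀ {A : Set} → List A → List A → List A
interleave [] ws = ws
interleave (u ∷ us) [] = u ∷ us
interleave (u ∷ us) (w ∷ ws) = u ∷ w ∷ interleave us ws

count-interleave : ∀ {A : Set} (f : A → Bool) us ws → count f (interleave us ws) ≡ count f us + count f ws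
count-interleave f [] ws = refl
count-interleave f (u ∷ us) [] = sym (+-identityʳ _)
count-interleave f (u ∷ us) (w ∷ ws) =
  trans (cong (λ c → ind (f u) + (ind (f w) + c)) (count-interleave f us ws))
    (shuffle (ind (f u)) (ind (f w)) (count f us) (count f ws))
  where
  shuffle : ∀ a b c d → a + (b + (c + d)) ≡ a + c + (b + d)
  shuffle = solve-∀

module _ {n : ℕ} where

  count-without : ∀ (h P : Fin n → Bool) pts → Unique pts → All (λ x → P x ≡ true) pts →
    count (λ w → h w ∧ P w) (allFin n) ≡ count h pts + count (λ w → (h w ∧ P w) ∧ not (any (w ==_) pts)) (allFin n)
  count-without h P [] _ _ = count-cong (λ w → sym (∧-identityʳ (h w ∧ P w))) (allFin n)
  count-without h P (x ∷ xs) (x∉xs ∷ unique) (Px ∷ Pxs) = begin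
      count (λ w → h w ∧ P w) (allFin n)
    ≡⟨ count-remove (λ w → h w ∧ P w) x (allFin n) (multiplicity-allFin x) ⟩
      ind (h x ∧ P x) + count (λ w → (h w ∧ P w) ∧ not (w == x)) (allFin n)
    ≡⟨ cong₂ _+_ (cong ind (trans (cong (h x ∧_) Px) (∧-identityʳ (h x))))
                 (count-cong (λ w → ∧-assoc (h w) (P w) _) (allFin n)) ⟩
      ind (h x) + count (λ w → h w ∧ (P w ∧ not (w == x))) (allFin n)
    ≡⟨ cong (ind (h x) +_) (count-without h (λ w → P w ∧ not (w == x)) xs unique (P-and-≢ xs Pxs x∉xs)) ⟩
      ind (h x) + (count h xs + count (λ w → (h w ∧ (P w ∧ not (w == x))) ∧ not (any (w ==_) xs)) (allFin n))
    ≡⟨ sym (+-assoc (ind (h x)) _ _) ⟩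
      count h (x ∷ xs) + count (λ w → (h w ∧ (P w ∧ not (w == x))) ∧ not (any (w ==_) xs)) (allFin n)
    ≡⟨ cong (count h (x ∷ xs) +_) (count-cong regroup (allFin n)) ⟩
      count h (x ∷ xs) + count (λ w → (h w ∧ P w) ∧ not (any (w ==_) (x ∷ xs))) (allFin n) ∎
    where
    open ≡-Reasoning
    P-and-≢ : ∀ ys → All (λ y → P y ≡ true) ys → All (x ≢_) ys → All (λ y → (P y ∧ not (y == x)) ≡ true) ys
    P-and-≢ [] [] [] = []
    P-and-≢ (y ∷ ys) (Py ∷ Pys) (x≢y ∷ x≢ys) = ∧-intro Py (not-false (==-≢ (≢-sym x≢y))) ∷ P-and-≢ ys Pys x≢ys
    regroup : ∀ w → ((h w ∧ (P w ∧ not (w == x))) ∧ not (any (w ==_) xs)) ≡ ((h w ∧ P w) ∧ not ((w == x) ∨ any (w ==_) xs))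
    regroup w with h w | P w | w == x
    ... | false | _ | _ = refl
    ... | true | false | _ = refl
    ... | true | true | true = refl
    ... | true | true | false = refl

-- In G₄ and G₅ the cycle alternates between V₁ and its complement except along the new pairs, so
-- breaks are eliminated using crossing steps only.
module AlternatingClasses (k : ℕ) (6≤k : 6 ≤ k) {n : ℕ} (G : Graph n) (V₁ V₂ : Subset n) (A B : List (Fin n × Fin n))
    (new : NewPairs G B) where

  open Partitioned k 6≤k G V₁ V₂ A B new public

  crossing : Fin n → Fin n → Bool
  crossing u v = (in₁ u xor in₁ v) ∨ pairInᵇ B u v

  Crossing : Fin n → Fin n → Set
  Crossing u v = crossing u v ≡ true

  adjˣ : Fin n → Fin n → Bool
  adjˣ u v = adj′ u v ∧ crossing u v

  adjˣ-sym : ∀ u v → adjˣ u v ≡ adjˣ v u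
  adjˣ-sym u v rewrite adj′-sym u v | xor-comm (in₁ u) (in₁ v) | pairInᵇ-sym B u v = refl

  adjˣ-irrefl : ∀ u → adjˣ u u ≡ false
  adjˣ-irrefl u rewrite adj′-irrefl u = refl

  Crossing-sym : ∀ {a b} → Crossing a b → Crossing b a
  Crossing-sym {a} {b} c = trans (cong₂ _∨_ (xor-comm (in₁ b) (in₁ a)) (pairInᵇ-sym B b a)) c

  adjˣ⇒Crossing : ∀ {a b} → adjˣ a b ≡ true → Crossing a b
  adjˣ⇒Crossing {a} = ∧-projʳ {adj′ a _}

  adjˣ⇒Adj′ : ∀ {a b} → adjˣ a b ≡ true → Adj′ a b
  adjˣ⇒Adj′ {a} {b} = ∧-projˡ {adj′ a b}

  in-out-crossing : ∀ {a b} → in₁ a ≡ true → in₁ b ≡ false → Crossing a b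
  in-out-crossing a-in b-out rewrite a-in | b-out = refl

  out-in-crossing : ∀ {a b} → in₁ a ≡ false → in₁ b ≡ true → Crossing a b
  out-in-crossing a-out b-in rewrite a-out | b-in = refl

  pair-crossing : ∀ {a b} → pairInᵇ B a b ≡ true → Crossing a b
  pair-crossing {a} {b} = ∨-introʳ (in₁ a xor in₁ b)

  cross-non-adjˣ : ∀ u z → in₁ u ≡ true → in₁ z ≡ false → adjˣ u z ≡ false → adj u z ≡ false ⊎ pairInᵇ A u z ≡ true
  cross-non-adjˣ u z u-in z-out no-adjˣ = non-adj′ u z (drop-crossing (adj′ u z) no-adjˣ)
    where
    drop-crossing : ∀ b → (b ∧ crossing u z) ≡ false → b ≡ false
    drop-crossing false _ = refl
    drop-crossing true e = ⊥-elim (true≢false (in-out-crossing u-in z-out) e)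

  crossing-same-side⇒adjˣ : ∀ {a b} → Crossing a b → adjˣ a b ≡ false → in₁ a ≡ in₁ b → ⊥
  crossing-same-side⇒adjˣ {a} {b} c no-adjˣ same = true≢false (∧-intro (new-pair-adj′ a b new-pair) c) no-adjˣ
    where
    new-pair : pairInᵇ B a b ≡ true
    new-pair with ∨-elim c
    ... | inj₂ p = p
    ... | inj₁ x = ⊥-elim (true≢false x (trans (cong (_xor in₁ b) same) (xor-same (in₁ b))))

  AlternatingBound : Set
  AlternatingBound = ∀ u w → in₁ u ≡ true → in₁ w ≡ false → adjˣ u w ≡ false →
    count (λ a → out₁ a ∧ not (adjˣ u a)) vertices + count (λ b → in₁ b ∧ not (adjˣ w b)) vertices < k

  interleave-chain : ∀ x us ws → in₁ x ≡ false → All (λ u → in₁ u ≡ true) us → All (λ w → out₁ w ≡ true) ws →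
    length us ≡ suc (length ws) → Chain Crossing x (interleave us ws) × in₁ (last x (interleave us ws)) ≡ true
  interleave-chain x (u ∷ []) [] x-out (u-in ∷ []) [] _ = (out-in-crossing x-out u-in ∷ []) , u-in
  interleave-chain x (u ∷ us) (w ∷ ws) x-out (u-in ∷ us-in) (w-out ∷ ws-out) len =
    let chain , end = interleave-chain w us ws (not-true w-out) us-in ws-out (suc-injective len) in
    (out-in-crossing x-out u-in ∷ (in-out-crossing u-in (not-true w-out) ∷ chain)) , end

  module _ (pairs-outside : ∀ u v → pairInᵇ B u v ≡ true → in₁ u ≡ false) where

    Crossing-leaves : ∀ {a b} → Crossing a b → in₁ a ≡ true → in₁ b ≡ false
    Crossing-leaves {a} {b} c a-in with in₁ b in b-in
    ... | false = refl
    ... | true with ∨-elim c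
    ...   | inj₂ p = ⊥-elim (true≢false a-in (pairs-outside a b p))
    ...   | inj₁ x = ⊥-elim (true≢false (subst (λ z → (z xor true) ≡ true) a-in x) refl)

    private
      module Restricted = BreakElimination adjˣ adjˣ-sym adjˣ-irrefl Crossing Crossing-sym adjˣ⇒Crossing
      module RestrictedExchanges = Exchanges adjˣ adjˣ-sym adjˣ-irrefl Crossing Crossing-sym adjˣ⇒Crossing _==_ ==-refl

    alternating-cycle : 3 ≤ n → count in₁ vertices ≡ k → AlternatingBound →
      ∀ h t → Chain Crossing h t → (h ∷ t) ≈ₘ vertices → in₁ h ≡ false → in₁ (last h t) ≡ false → Adj′ (last h t) h →
      Hamiltonian (Modified G A B)
    alternating-cycle 3≤n size bound h t chain all h-out end-out closing =
      let t* , chain* , all* , end* = Restricted.eliminate-breaks h vertices (last h t) exchanges t chain all refl in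
      cycle⇒hamiltonian 3≤n h t* (chain-map adjˣ⇒Adj′ chain*) (subst (λ z → Adj′ z h) (sym end*) closing) all*
      where
      open RestrictedExchanges.Alternating in₁ Crossing-leaves
      exchanges : Restricted.ExchangeCondition h vertices (last h t)
      exchanges = alternating⇒exchanges k h vertices (last h t) h-out end-out size crossing-same-side⇒adjˣ bound

    interleaved-cycle : 3 ≤ n → count in₁ vertices ≡ k → AlternatingBound →
      ∀ h pre U W x → Chain Crossing h pre → in₁ (last h pre) ≡ false → All (λ u → in₁ u ≡ true) U → All (λ w → out₁ w ≡ true) W →
      length U ≡ suc (length W) → in₁ h ≡ false → in₁ x ≡ false → Adj′ x h →
      (h ∷ (pre ++ interleave U W ++ x ∷ [])) ≈ₘ vertices → Hamiltonian (Modified G A B)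
    interleaved-cycle 3≤n size bound h pre U W x prefix prefix-out U-in W-out length-U h-out x-out closing all =
      alternating-cycle 3≤n size bound h t chain all h-out (subst (λ z → in₁ z ≡ false) (sym end) x-out) (subst (λ z → Adj′ z h) (sym end) closing)
      where
      t : List (Fin n)
      t = pre ++ interleave U W ++ x ∷ []
      end : last h t ≡ x
      end = trans (last-++ h pre (interleave U W ++ x ∷ [])) (last-++ (last h pre) (interleave U W) (x ∷ []))
      alternation : Chain Crossing (last h pre) (interleave U W) × in₁ (last (last h pre) (interleave U W)) ≡ true
      alternation = interleave-chain (last h pre) U W prefix-out U-in W-out length-U
      chain : Chain Crossing h t
      chain = chain-++ prefix (chain-++ (proj₁ alternation) (in-out-crossing (proj₂ alternation) x-out ∷ []))

  endpoints-outside : ∀ L → All (λ e → in₁ (proj₁ e) ≡ false × in₁ (proj₂ e) ≡ false) L →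
    ∀ u v → pairInᵇ L u v ≡ true → in₁ u ≡ false
  endpoints-outside ((a , b) ∷ L) ((a-out , b-out) ∷ rest) u v p with ∨-elim p
  ... | inj₂ p′ = endpoints-outside L rest u v p′
  ... | inj₁ p′ with samePairᵇ-sound (a , b) u v p′
  ...   | inj₁ (refl , _) = a-out
  ...   | inj₂ (_ , refl) = b-out

  remaining : List (Fin n) → List (Fin n)
  remaining pts = filterᵇ (λ w → out₁ w ∧ not (any (w ==_) pts)) vertices

  remaining-outside : ∀ pts → All (λ w → out₁ w ≡ true) (remaining pts)
  remaining-outside pts = All.map (λ {w} → ∧-projˡ {out₁ w}) (filterᵇ-all _ vertices)

  partition-count : ∀ pts → Unique pts → All (λ w → out₁ w ≡ true) pts → ∀ f →
    count f vertices ≡ count f (filterᵇ in₁ vertices) + (count f pts + count f (remaining pts))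
  partition-count pts unique outside f = begin
      count f vertices
    ≡⟨ count-split f in₁ vertices ⟩
      count (λ w → f w ∧ in₁ w) vertices + count (λ w → f w ∧ out₁ w) vertices
    ≡⟨ cong₂ _+_ (count-cong (λ w → ∧-comm (f w) (in₁ w)) vertices) (count-without f out₁ pts unique outside) ⟩
      count (λ w → in₁ w ∧ f w) vertices + (count f pts + count (λ w → (f w ∧ out₁ w) ∧ not (any (w ==_) pts)) vertices)
    ≡⟨ sym (cong₂ _+_ (count-filter in₁ f vertices) (cong (count f pts +_) (trans (count-filter _ f vertices) (count-cong reorder vertices)))) ⟩
      count f (filterᵇ in₁ vertices) + (count f pts + count f (remaining pts)) ∎
    where
    open ≡-Reasoning
    reorder : ∀ w → ((out₁ w ∧ not (any (w ==_) pts)) ∧ f w) ≡ ((f w ∧ out₁ w) ∧ not (any (w ==_) pts))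
    reorder w = trans (∧-comm _ (f w)) (sym (∧-assoc (f w) (out₁ w) _))

  remaining-length : ∀ pts → Unique pts → All (λ w → out₁ w ≡ true) pts →
    length pts + length (remaining pts) ≡ count out₁ vertices
  remaining-length pts unique outside = sym (begin
      count out₁ vertices
    ≡⟨ count-without (λ _ → true) out₁ pts unique outside ⟩
      count (λ _ → true) pts + count (λ w → (true ∧ out₁ w) ∧ not (any (w ==_) pts)) vertices
    ≡⟨ cong₂ _+_ (count-true pts) (sym (length-filter _ vertices)) ⟩
      length pts + length (remaining pts) ∎)
    where open ≡-Reasoning

  misses-only-removed : ∀ u (side : Fin n → Bool) → (∀ z → side z ≡ true → adjˣ u z ≡ false → pairInᵇ A u z ≡ true) →
    count (λ z → side z ∧ not (adjˣ u z)) vertices ≤ length A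
  misses-only-removed u side removed =
    ≤-trans (count-mono (λ z m → removed z (∧-projˡ m) (not-true (∧-projʳ {side z} m))) vertices) (count-pairInᵇ A u)

  length-V₁ : length (filterᵇ in₁ vertices) ≡ ∣ V₁ ∣
  length-V₁ = trans (length-filter in₁ vertices) size-V₁

  case-G4 : IsG4 k G V₁ V₂ → length A ≤ 1 → ∀ a b → B ≡ (a , b) ∷ [] → a ∈ V₂ → b ∈ V₂ → Hamiltonian (Modified G A B)
  case-G4 (n≡ , cover , disjoint , ∣V₁∣≡ , _ , _ , complete-bipartite) A≤1 a b B≡ a∈ b∈ =
    interleaved-cycle (endpoints-outside B (subst (All _) (sym B≡) ((a-out , b-out) ∷ [])))
      (subst (3 ≤_) (sym n≡) (3≤2k+ 1)) (trans size-V₁ ∣V₁∣≡) bound b [] U W a [] b-out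
      (filterᵇ-all in₁ vertices) (remaining-outside pts) length-U b-out a-out (only-pair-adj′ _ B≡ a b (inj₁ (refl , refl))) all
    where
    a-out : in₁ a ≡ false
    a-out = not-true (∈V₂⇒outside disjoint a∈)
    b-out : in₁ b ≡ false
    b-out = not-true (∈V₂⇒outside disjoint b∈)
    a≢b : a ≢ b
    a≢b = proj₁ (proj₁ (subst (NewPairs G) B≡ new))
    pts : List (Fin n)
    pts = a ∷ b ∷ []
    unique : Unique pts
    unique = (a≢b ∷ []) ∷ [] ∷ []
    outside : All (λ w → out₁ w ≡ true) pts
    outside = not-false a-out ∷ not-false b-out ∷ []
    U W : List (Fin n)
    U = filterᵇ in₁ vertices
    W = remaining pts
    length-U : length U ≡ suc (length W)
    length-U = trans length-V₁ (trans ∣V₁∣≡ (suc-injective (trans (+-comm 1 k) (sym (trans (remaining-length pts unique outside) size₂)))))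
      where
      size₂ : count out₁ vertices ≡ k + 1
      size₂ = size-outside (k + 1) (trans n≡ (sym (trans (cong (_+ (k + 1)) ∣V₁∣≡) (k+[k+1] k))))
        where
        k+[k+1] : ∀ k → k + (k + 1) ≡ 2 * k + 1
        k+[k+1] = solve-∀
    all : (b ∷ (interleave U W ++ a ∷ [])) ≈ₘ vertices
    all f = trans (cong (ind (f b) +_) (trans (count-++ f (interleave U W) (a ∷ [])) (cong (_+ (ind (f a) + 0)) (count-interleave f U W))))
      (trans (shuffle (ind (f b)) (count f U) (count f W) (ind (f a))) (sym (partition-count pts unique outside f)))
      where
      shuffle : ∀ fb cu cw fa → fb + (cu + cw + (fa + 0)) ≡ cu + (fa + (fb + 0) + cw)
      shuffle = solve-∀
    bound : AlternatingBound
    bound u w u-in w-out _ = ≤-trans (s≤s (+-mono-≤ (≤-trans (misses-only-removed u out₁ out-removed) A≤1)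
                                                      (≤-trans (misses-only-removed w in₁ in-removed) A≤1))) 3≤k
      where
      out-removed : ∀ z → out₁ z ≡ true → adjˣ u z ≡ false → pairInᵇ A u z ≡ true
      out-removed z z-out no-adjˣ with cross-non-adjˣ u z u-in (not-true z-out) no-adjˣ
      ... | inj₂ removed = removed
      ... | inj₁ no-edge = ⊥-elim (true≢false (complete-bipartite u z (lookup⇒∈ u-in) (outside⇒∈V₂ cover z-out)) no-edge)
      in-removed : ∀ z → in₁ z ≡ true → adjˣ w z ≡ false → pairInᵇ A w z ≡ true
      in-removed z z-in no-adjˣ with cross-non-adjˣ z w z-in w-out (trans (adjˣ-sym z w) no-adjˣ)
      ... | inj₂ removed = trans (pairInᵇ-sym A w z) removed
      ... | inj₁ no-edge = ⊥-elim (true≢false (complete-bipartite z w (lookup⇒∈ z-in) (outside⇒∈V₂ cover (not-false w-out))) no-edge)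

module _ {n : ℕ} where

  private
    covers-both : ∀ (e : Fin n × Fin n) u w z z′ → u ≢ w → samePairᵇ e u z ≡ true → samePairᵇ e w z′ ≡ true →
      samePairᵇ e u w ≡ true
    covers-both (a , b) u w z z′ u≢w h h′ with samePairᵇ-sound (a , b) u z h | samePairᵇ-sound (a , b) w z′ h′
    ... | inj₁ (refl , refl) | inj₁ (refl , refl) = ⊥-elim (u≢w refl)
    ... | inj₁ (refl , refl) | inj₂ (refl , refl) = samePairᵇ-complete (a , b) a b (inj₁ (refl , refl))
    ... | inj₂ (refl , refl) | inj₁ (refl , refl) = samePairᵇ-complete (a , b) b a (inj₂ (refl , refl))
    ... | inj₂ (refl , refl) | inj₂ (refl , refl) = ⊥-elim (u≢w refl)

  pair-at-two-ends : ∀ e u w → u ≢ w →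
    count (samePairᵇ e u) (allFin n) + count (samePairᵇ e w) (allFin n) ≤ 1 + ind (samePairᵇ e u w)
  pair-at-two-ends e u w u≢w with count (samePairᵇ e u) (allFin n) in at-u | count (samePairᵇ e w) (allFin n) in at-w
  ... | zero | _ = ≤-trans (subst (_≤ 1) at-w (count-samePairᵇ e w)) (m≤m+n 1 _)
  ... | suc i | zero = ≤-trans (≤-reflexive (+-identityʳ (suc i))) (≤-trans (subst (_≤ 1) at-u (count-samePairᵇ e u)) (m≤m+n 1 _))
  ... | suc i | suc j
    with count-witness _ (allFin n) (subst (1 ≤_) (sym at-u) (s≤s z≤n)) | count-witness _ (allFin n) (subst (1 ≤_) (sym at-w) (s≤s z≤n))
  ...   | z , uz | z′ , wz′ rewrite covers-both e u w z z′ u≢w uz wz′ =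
    +-mono-≤ (subst (_≤ 1) at-u (count-samePairᵇ e u)) (subst (_≤ 1) at-w (count-samePairᵇ e w))

  two-pairs-at-two-ends : ∀ e₁ e₂ u w → u ≢ w →
    count (pairInᵇ (e₁ ∷ e₂ ∷ []) u) (allFin n) + count (pairInᵇ (e₁ ∷ e₂ ∷ []) w) (allFin n)
      ≤ 1 + ind (samePairᵇ e₁ u w) + (1 + ind (samePairᵇ e₂ u w))
  two-pairs-at-two-ends e₁ e₂ u w u≢w = begin
      count (pairInᵇ (e₁ ∷ e₂ ∷ []) u) (allFin n) + count (pairInᵇ (e₁ ∷ e₂ ∷ []) w) (allFin n)
    ≤⟨ +-mono-≤ (split u) (split w) ⟩
      count (samePairᵇ e₁ u) (allFin n) + count (samePairᵇ e₂ u) (allFin n) + (count (samePairᵇ e₁ w) (allFin n) + count (samePairᵇ e₂ w) (allFin n))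
    ≡⟨ interchange (count (samePairᵇ e₁ u) (allFin n)) _ _ _ ⟩
      count (samePairᵇ e₁ u) (allFin n) + count (samePairᵇ e₁ w) (allFin n) + (count (samePairᵇ e₂ u) (allFin n) + count (samePairᵇ e₂ w) (allFin n))
    ≤⟨ +-mono-≤ (pair-at-two-ends e₁ u w u≢w) (pair-at-two-ends e₂ u w u≢w) ⟩
      1 + ind (samePairᵇ e₁ u w) + (1 + ind (samePairᵇ e₂ u w)) ∎
    where
    open ≤-Reasoning
    split : ∀ x → count (pairInᵇ (e₁ ∷ e₂ ∷ []) x) (allFin n) ≤ count (samePairᵇ e₁ x) (allFin n) + count (samePairᵇ e₂ x) (allFin n)
    split x = ≤-trans (≤-reflexive (count-cong (λ z → cong (samePairᵇ e₁ x z ∨_) (∨-identityʳ _)) (allFin n)))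
                      (count-∨ (samePairᵇ e₁ x) (samePairᵇ e₂ x) (allFin n))

  pairs-at-two-ends : ∀ (L : List (Fin n × Fin n)) → length L ≤ 2 → ∀ u w → u ≢ w →
    count (pairInᵇ L u) (allFin n) + count (pairInᵇ L w) (allFin n) ≤ 2 + ind (pairInᵇ L u w)
  pairs-at-two-ends [] _ u w _ = ≤-trans (+-mono-≤ (count-pairInᵇ [] u) (count-pairInᵇ [] w)) z≤n
  pairs-at-two-ends (e ∷ []) _ u w _ = ≤-trans (+-mono-≤ (count-pairInᵇ (e ∷ []) u) (count-pairInᵇ (e ∷ []) w)) (m≤m+n 2 _)
  pairs-at-two-ends (e₁ ∷ e₂ ∷ []) _ u w u≢w with samePairᵇ e₁ u w in is-e₁ | samePairᵇ e₂ u w in is-e₂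
  ... | true | true = ≤-trans (+-mono-≤ (count≤1 _ (λ z z′ h h′ → trans (partner u w is-e₁ is-e₂ z h) (sym (partner u w is-e₁ is-e₂ z′ h′))))
                                       (count≤1 _ (λ z z′ h h′ → trans (partner w u (flip e₁ is-e₁) (flip e₂ is-e₂) z h)
                                                                      (sym (partner w u (flip e₁ is-e₁) (flip e₂ is-e₂) z′ h′)))))
                              (m≤m+n 2 _)
    where
    flip : ∀ e → samePairᵇ e u w ≡ true → samePairᵇ e w u ≡ true
    flip e h = trans (samePairᵇ-sym e w u) h
    partner : ∀ x y → samePairᵇ e₁ x y ≡ true → samePairᵇ e₂ x y ≡ true → ∀ z → pairInᵇ (e₁ ∷ e₂ ∷ []) x z ≡ true → z ≡ y
    partner x y x-e₁ x-e₂ z h with ∨-elim h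
    ... | inj₁ h₁ = samePairᵇ-partner e₁ x z y h₁ x-e₁
    ... | inj₂ h₂ with ∨-elim h₂
    ...   | inj₁ h₃ = samePairᵇ-partner e₂ x z y h₃ x-e₂
  ... | true | false = ≤-trans (two-pairs-at-two-ends e₁ e₂ u w u≢w) (≤-reflexive (cong₂ (λ x y → 1 + ind x + (1 + ind y)) is-e₁ is-e₂))
  ... | false | b₂ = ≤-trans (two-pairs-at-two-ends e₁ e₂ u w u≢w)
                       (≤-trans (≤-reflexive (cong₂ (λ x y → 1 + ind x + (1 + ind y)) is-e₁ is-e₂)) (fits b₂))
    where
    fits : ∀ b → 1 + ind false + (1 + ind b) ≤ 2 + ind (b ∨ false)
    fits true = ≤-refl
    fits false = ≤-refl
  pairs-at-two-ends (_ ∷ _ ∷ _ ∷ _) (s≤s (s≤s ())) u w _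

module ClassG5 (k : ℕ) (6≤k : 6 ≤ k) {n : ℕ} (G : Graph n) (V₁ V₂ : Subset n) (A B : List (Fin n × Fin n))
    (new : NewPairs G B) (n≡ : n ≡ 2 * k + 2) (cover : Covers k G V₁ V₂) (disjoint : Disjoint k G V₁ V₂) (∣V₁∣≡ : ∣ V₁ ∣ ≡ k)
    (one-edge : ∀ a b c d → a ∈ V₂ → b ∈ V₂ → c ∈ V₂ → d ∈ V₂ → Edge G a b → Edge G c d → SamePair (a , b) c d)
    (min-deg : MinDeg k G V₁ V₂) (edges-A : EdgesOf G A) (A≤2 : length A ≤ 2) where

  open AlternatingClasses k 6≤k G V₁ V₂ A B new

  size₁ : count in₁ vertices ≡ k
  size₁ = trans size-V₁ ∣V₁∣≡

  size₂ : count out₁ vertices ≡ k + 2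
  size₂ = size-outside (k + 2) (trans n≡ (sym (trans (cong (_+ (k + 2)) ∣V₁∣≡) (k+[k+2] k))))
    where
    k+[k+2] : ∀ k → k + (k + 2) ≡ 2 * k + 2
    k+[k+2] = solve-∀

  hits₁ misses₁ misses₂ : Fin n → ℕ
  hits₁ z = count (λ y → in₁ y ∧ adj z y) vertices
  misses₁ z = count (λ y → in₁ y ∧ not (adj z y)) vertices
  misses₂ u = count (λ z → out₁ z ∧ not (adj u z)) vertices

  OutsideNeighbour : Fin n → Set
  OutsideNeighbour z = ∃ λ x → out₁ x ≡ true × adj z x ≡ true

  outside-neighbours≤1 : ∀ z → out₁ z ≡ true → count (λ y → out₁ y ∧ adj z y) vertices ≤ 1
  outside-neighbours≤1 z z-out = count≤1 _ same
    where
    same : ∀ y y′ → (out₁ y ∧ adj z y) ≡ true → (out₁ y′ ∧ adj z y′) ≡ true → y ≡ y′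
    same y y′ h h′ with one-edge z y z y′ (outside⇒∈V₂ cover z-out) (outside⇒∈V₂ cover (∧-projˡ h))
                             (outside⇒∈V₂ cover z-out) (outside⇒∈V₂ cover (∧-projˡ h′)) (∧-projʳ {out₁ y} h) (∧-projʳ {out₁ y′} h′)
    ... | inj₁ (_ , y≡y′) = y≡y′
    ... | inj₂ (z≡y′ , y≡z) = ⊥-elim (true≢false (subst (λ v → adj z v ≡ true) y≡z (∧-projʳ {out₁ y} h)) (Graph.irrefl G z))

  hits+misses₁ : ∀ z → hits₁ z + misses₁ z ≡ k
  hits+misses₁ z = trans (sym (count-split in₁ (adj z) vertices)) size₁

  degree-split : ∀ z → k ≤ hits₁ z + count (λ y → out₁ y ∧ adj z y) vertices
  degree-split z = ≤-trans (subst (k ≤_) (deg≡count G z) (min-deg z)) (≤-reflexive (trans (count-split (adj z) in₁ vertices)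
    (cong₂ _+_ (count-cong (λ y → ∧-comm (adj z y) (in₁ y)) vertices) (count-cong (λ y → ∧-comm (adj z y) (out₁ y)) vertices))))

  misses₁≤1 : ∀ z → out₁ z ≡ true → misses₁ z ≤ 1
  misses₁≤1 z z-out = +-cancelˡ-≤ (hits₁ z) _ _
    (≤-trans (≤-reflexive (hits+misses₁ z)) (≤-trans (degree-split z) (+-monoʳ-≤ (hits₁ z) (outside-neighbours≤1 z z-out))))

  isolated⇒misses₁≡0 : ∀ z → count (λ y → out₁ y ∧ adj z y) vertices ≡ 0 → misses₁ z ≡ 0
  isolated⇒misses₁≡0 z isolated = n≤0⇒n≡0 (+-cancelˡ-≤ (hits₁ z) _ _
    (≤-trans (≤-reflexive (hits+misses₁ z)) (≤-trans (degree-split z) (≤-reflexive (cong (hits₁ z +_) isolated)))))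

  outside-neighbour : ∀ z → 1 ≤ misses₁ z → OutsideNeighbour z
  outside-neighbour z missing with count (λ y → out₁ y ∧ adj z y) vertices in neighbours
  ... | zero = ⊥-elim (<-irrefl refl (subst (0 <_) (isolated⇒misses₁≡0 z neighbours) missing))
  ... | suc _ with count-witness _ vertices (subst (1 ≤_) (sym neighbours) (s≤s z≤n))
  ...   | x , found = x , ∧-projˡ found , ∧-projʳ {out₁ x} found

  edge-ends : ∀ z x → out₁ z ≡ true → out₁ x ≡ true → adj z x ≡ true → ∀ z′ → out₁ z′ ≡ true → OutsideNeighbour z′ → z′ ≡ z ⊎ z′ ≡ x
  edge-ends z x z-out x-out zx z′ z′-out (y′ , y′-out , z′y′)
    with one-edge z x z′ y′ (outside⇒∈V₂ cover z-out) (outside⇒∈V₂ cover x-out) (outside⇒∈V₂ cover z′-out) (outside⇒∈V₂ cover y′-out) zx z′y′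
  ... | inj₁ (z≡z′ , _) = inj₁ (sym z≡z′)
  ... | inj₂ (_ , x≡z′) = inj₂ (sym x≡z′)

  missed⇒misses₁ : ∀ u z → in₁ u ≡ true → adj u z ≡ false → 1 ≤ misses₁ z
  missed⇒misses₁ u z u-in uz = count-pos _ u (∧-intro u-in (not-false (trans (Graph.sym G z u) uz)))

  misses₂≤2 : ∀ u → in₁ u ≡ true → misses₂ u ≤ 2
  misses₂≤2 u u-in with misses₂ u in missed
  ... | zero = z≤n
  ... | suc _ with count-witness _ vertices (subst (1 ≤_) (sym missed) (s≤s z≤n))
  ...   | z₀ , found with outside-neighbour z₀ (missed⇒misses₁ u z₀ u-in (not-true (∧-projʳ {out₁ z₀} found)))
  ...     | x₀ , x₀-out , z₀x₀ = subst (_≤ 2) missed (count≤2 _ z₀ x₀ λ z h →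
            edge-ends z₀ x₀ (∧-projˡ found) x₀-out z₀x₀ z (∧-projˡ h) (outside-neighbour z (missed⇒misses₁ u z u-in (not-true (∧-projʳ {out₁ z} h)))))

  misses₂-given-neighbour : ∀ u w → in₁ u ≡ true → out₁ w ≡ true → OutsideNeighbour w → misses₂ u ≤ ind (not (adj u w)) + 1
  misses₂-given-neighbour u w u-in w-out (x , x-out , wx) =
    ≤-trans (≤-reflexive (count-remove (λ z → out₁ z ∧ not (adj u z)) w vertices (multiplicity-allFin w)))
      (+-mono-≤ (≤-reflexive (cong (λ b → ind (b ∧ not (adj u w))) w-out)) (count≤1 _ (λ z z′ h h′ → trans (is-x z h) (sym (is-x z′ h′)))))
    where
    is-x : ∀ z → ((out₁ z ∧ not (adj u z)) ∧ not (z == w)) ≡ true → z ≡ x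
    is-x z h with edge-ends w x w-out x-out wx z (∧-projˡ (∧-projˡ h))
                    (outside-neighbour z (missed⇒misses₁ u z u-in (not-true (∧-projʳ {out₁ z} (∧-projˡ h)))))
    ... | inj₂ z≡x = z≡x
    ... | inj₁ z≡w = ⊥-elim (true≢false (subst (λ v → (v == w) ≡ true) (sym z≡w) (==-refl w)) (not-true (∧-projʳ {out₁ z ∧ not (adj u z)} h)))

  misses-at-two-ends : ∀ u w → in₁ u ≡ true → out₁ w ≡ true → misses₂ u + misses₁ w ≤ 2 + ind (not (adj u w))
  misses-at-two-ends u w u-in w-out with count (λ y → out₁ y ∧ adj w y) vertices in neighbours
  ... | zero = ≤-trans (≤-reflexive (trans (cong (misses₂ u +_) (isolated⇒misses₁≡0 w neighbours)) (+-identityʳ _)))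
                 (≤-trans (misses₂≤2 u u-in) (m≤m+n 2 _))
  ... | suc _ with count-witness _ vertices (subst (1 ≤_) (sym neighbours) (s≤s z≤n))
  ...   | x , found = ≤-trans (+-mono-≤ (misses₂-given-neighbour u w u-in w-out (x , ∧-projˡ found , ∧-projʳ {out₁ x} found)) (misses₁≤1 w w-out))
                         (≤-reflexive (two-more (ind (not (adj u w)))))
    where
    two-more : ∀ b → b + 1 + 1 ≡ 2 + b
    two-more = solve-∀

  missing-or-removed≤1 : ∀ u w → in₁ u ≡ true → in₁ w ≡ false → adjˣ u w ≡ false → ind (not (adj u w)) + ind (pairInᵇ A u w) ≤ 1
  missing-or-removed≤1 u w u-in w-out no-adjˣ with cross-non-adjˣ u w u-in w-out no-adjˣ
  ... | inj₁ no-edge with pairInᵇ A u w in removed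
  ...   | true = ⊥-elim (true≢false (pairs-are-edges G A edges-A u w removed) no-edge)
  ...   | false rewrite no-edge = ≤-refl
  missing-or-removed≤1 u w u-in w-out no-adjˣ | inj₂ removed rewrite removed | pairs-are-edges G A edges-A u w removed = ≤-refl

  bound : AlternatingBound
  bound u w u-in w-out no-adjˣ = ≤-trans (s≤s (begin
      count (λ z → out₁ z ∧ not (adjˣ u z)) vertices + count (λ z → in₁ z ∧ not (adjˣ w z)) vertices
    ≤⟨ +-mono-≤ (misses-or-removed u out₁ (λ z z-out → cross-non-adjˣ u z u-in (not-true z-out)))
                (misses-or-removed w in₁ (λ z z-in no-adjˣ → swap (cross-non-adjˣ z w z-in w-out (trans (adjˣ-sym z w) no-adjˣ)))) ⟩
      misses₂ u + count (pairInᵇ A u) vertices + (misses₁ w + count (pairInᵇ A w) vertices)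
    ≡⟨ interchange (misses₂ u) _ _ _ ⟩
      misses₂ u + misses₁ w + (count (pairInᵇ A u) vertices + count (pairInᵇ A w) vertices)
    ≤⟨ +-mono-≤ (misses-at-two-ends u w u-in (not-false w-out)) (pairs-at-two-ends A A≤2 u w (outside-≢ u-in (not-false w-out))) ⟩
      2 + ind (not (adj u w)) + (2 + ind (pairInᵇ A u w))
    ≡⟨ regroup (ind (not (adj u w))) (ind (pairInᵇ A u w)) ⟩
      4 + (ind (not (adj u w)) + ind (pairInᵇ A u w))
    ≤⟨ +-monoʳ-≤ 4 (missing-or-removed≤1 u w u-in w-out no-adjˣ) ⟩
      5 ∎)) 6≤k
    where
    open ≤-Reasoning
    regroup : ∀ x y → 2 + x + (2 + y) ≡ 4 + (x + y)
    regroup = solve-∀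
    swap : ∀ {z} → adj z w ≡ false ⊎ pairInᵇ A z w ≡ true → adj w z ≡ false ⊎ pairInᵇ A w z ≡ true
    swap {z} (inj₁ no-edge) = inj₁ (trans (Graph.sym G w z) no-edge)
    swap {z} (inj₂ removed) = inj₂ (trans (pairInᵇ-sym A w z) removed)
    misses-or-removed : ∀ v (side : Fin n → Bool) → (∀ z → side z ≡ true → adjˣ v z ≡ false → adj v z ≡ false ⊎ pairInᵇ A v z ≡ true) →
      count (λ z → side z ∧ not (adjˣ v z)) vertices ≤ count (λ z → side z ∧ not (adj v z)) vertices + count (pairInᵇ A v) vertices
    misses-or-removed v side why = ≤-trans (count-mono reason vertices) (count-∨ _ (pairInᵇ A v) vertices)
      where
      reason : ∀ z → (side z ∧ not (adjˣ v z)) ≡ true → ((side z ∧ not (adj v z)) ∨ pairInᵇ A v z) ≡ true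
      reason z h with why z (∧-projˡ {side z} h) (not-true (∧-projʳ {side z} h))
      ... | inj₁ no-edge = ∨-introˡ (pairInᵇ A v z) (∧-intro (∧-projˡ {side z} h) (not-false no-edge))
      ... | inj₂ removed = ∨-introʳ (side z ∧ not (adj v z)) removed

  module _ (a b c d : Fin n) (B≡ : B ≡ (a , b) ∷ (c , d) ∷ []) (a∈ : a ∈ V₂) (b∈ : b ∈ V₂) (c∈ : c ∈ V₂) (d∈ : d ∈ V₂) where

    out : ∀ {w} → w ∈ V₂ → in₁ w ≡ false
    out w∈ = not-true (∈V₂⇒outside disjoint w∈)

    pairs-outside : ∀ u v → pairInᵇ B u v ≡ true → in₁ u ≡ false
    pairs-outside = endpoints-outside B (subst (All _) (sym B≡) ((out a∈ , out b∈) ∷ (out c∈ , out d∈) ∷ []))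

    pair₁ : ∀ u v → SamePair (a , b) u v → pairInᵇ B u v ≡ true
    pair₁ u v same = subst (λ L → pairInᵇ L u v ≡ true) (sym B≡) (∨-introˡ _ (samePairᵇ-complete (a , b) u v same))

    pair₂ : ∀ u v → SamePair (c , d) u v → pairInᵇ B u v ≡ true
    pair₂ u v same = subst (λ L → pairInᵇ L u v ≡ true) (sym B≡) (∨-introʳ (samePairᵇ (a , b) u v) (∨-introˡ _ (samePairᵇ-complete (c , d) u v same)))

    3≤n : 3 ≤ n
    3≤n = subst (3 ≤_) (sym n≡) (3≤2k+ 2)

    a≢b : a ≢ b
    a≢b = proj₁ (proj₁ (subst (NewPairs G) B≡ new))

    c≢d : c ≢ d
    c≢d = proj₁ (proj₁ (proj₂ (subst (NewPairs G) B≡ new)))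

    U : List (Fin n)
    U = filterᵇ in₁ vertices

    length-U : length U ≡ k
    length-U = trans length-V₁ ∣V₁∣≡

    -- The new pairs xy and yz share y: the cycle y z (V₁ and the rest alternately) x y.
    through-shared : ∀ x y z → x ≢ y → y ≢ z → x ≢ z → in₁ x ≡ false → in₁ y ≡ false → in₁ z ≡ false →
      pairInᵇ B x y ≡ true → pairInᵇ B y z ≡ true → Hamiltonian (Modified G A B)
    through-shared x y z x≢y y≢z x≢z x-out y-out z-out xy yz =
      interleaved-cycle pairs-outside 3≤n size₁ bound y (z ∷ []) U W x (pair-crossing yz ∷ []) z-out
        (filterᵇ-all in₁ vertices) (remaining-outside pts) length-U-W y-out x-out (new-pair-adj′ x y xy) all
      where
      pts : List (Fin n)
      pts = x ∷ y ∷ z ∷ []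
      unique : Unique pts
      unique = (x≢y ∷ x≢z ∷ []) ∷ (y≢z ∷ []) ∷ [] ∷ []
      outside : All (λ w → out₁ w ≡ true) pts
      outside = not-false x-out ∷ not-false y-out ∷ not-false z-out ∷ []
      W : List (Fin n)
      W = remaining pts
      length-U-W : length U ≡ suc (length W)
      length-U-W = trans length-U (suc-injective (suc-injective (trans (+-comm 2 k) (sym (trans (remaining-length pts unique outside) size₂)))))
      all : (y ∷ (z ∷ [] ++ interleave U W ++ x ∷ [])) ≈ₘ vertices
      all f = trans (cong (λ c → ind (f y) + (ind (f z) + c)) (trans (count-++ f (interleave U W) (x ∷ [])) (cong (_+ (ind (f x) + 0)) (count-interleave f U W))))
        (trans (shuffle (ind (f y)) (ind (f z)) (count f U) (count f W) (ind (f x))) (sym (partition-count pts unique outside f)))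
        where
        shuffle : ∀ fy fz cu cw fx → fy + (fz + (cu + cw + (fx + 0))) ≡ cu + (fx + (fy + (fz + 0)) + cw)
        shuffle = solve-∀

    -- Disjoint new pairs ab and cd: the cycle b u₁ c d (V₁ ∖ u₁ and the rest alternately) a b.
    through-disjoint : a ≢ c → a ≢ d → b ≢ c → b ≢ d → Hamiltonian (Modified G A B)
    through-disjoint a≢c a≢d b≢c b≢d with U in U≡ | filterᵇ-all in₁ vertices | length-U
    ... | [] | _ | k≡0 = ⊥-elim (<-irrefl k≡0 (≤-trans (s≤s z≤n) 6≤k))
    ... | u₁ ∷ U′ | u₁-in ∷ U′-in | length-U′ =
      interleaved-cycle pairs-outside 3≤n size₁ bound b (u₁ ∷ c ∷ d ∷ []) U′ W a
        (out-in-crossing (out b∈) u₁-in ∷ in-out-crossing u₁-in (out c∈) ∷ pair-crossing (pair₂ c d (inj₁ (refl , refl))) ∷ [])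
        (out d∈) U′-in (remaining-outside pts) length-U′-W (out b∈) (out a∈) (new-pair-adj′ a b (pair₁ a b (inj₁ (refl , refl)))) all
      where
      pts : List (Fin n)
      pts = a ∷ b ∷ c ∷ d ∷ []
      unique : Unique pts
      unique = (a≢b ∷ a≢c ∷ a≢d ∷ []) ∷ (b≢c ∷ b≢d ∷ []) ∷ (c≢d ∷ []) ∷ [] ∷ []
      outside : All (λ w → out₁ w ≡ true) pts
      outside = not-false (out a∈) ∷ not-false (out b∈) ∷ not-false (out c∈) ∷ not-false (out d∈) ∷ []
      W : List (Fin n)
      W = remaining pts
      length-U′-W : length U′ ≡ suc (length W)
      length-U′-W = suc-injective (trans length-U′ (suc-injective (suc-injective (trans (+-comm 2 k) (sym (trans (remaining-length pts unique outside) size₂))))))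
      all : (b ∷ (u₁ ∷ c ∷ d ∷ [] ++ interleave U′ W ++ a ∷ [])) ≈ₘ vertices
      all f = trans (cong (λ t → ind (f b) + (ind (f u₁) + (ind (f c) + (ind (f d) + t))))
                      (trans (count-++ f (interleave U′ W) (a ∷ [])) (cong (_+ (ind (f a) + 0)) (count-interleave f U′ W))))
        (trans (shuffle (ind (f b)) (ind (f u₁)) (ind (f c)) (ind (f d)) (count f U′) (count f W) (ind (f a)))
          (sym (trans (partition-count pts unique outside f) (cong (λ L → count f L + (count f pts + count f W)) U≡))))
        where
        shuffle : ∀ fb fu fc fd cu cw fa → fb + (fu + (fc + (fd + (cu + cw + (fa + 0))))) ≡ fu + cu + (fa + (fb + (fc + (fd + 0))) + cw)
        shuffle = solve-∀

    case-G5 : ¬ SamePair (a , b) c d → Hamiltonian (Modified G A B)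
    case-G5 distinct with a ≟ c | a ≟ d | b ≟ c | b ≟ d
    ... | yes refl | _ | _ | _ = through-shared b a d (≢-sym a≢b) c≢d (λ b≡d → distinct (inj₁ (refl , b≡d)))
                                   (out b∈) (out a∈) (out d∈) (pair₁ b a (inj₂ (refl , refl))) (pair₂ a d (inj₁ (refl , refl)))
    ... | no _ | yes refl | _ | _ = through-shared b a c (≢-sym a≢b) (≢-sym c≢d) (λ b≡c → distinct (inj₂ (refl , b≡c)))
                                   (out b∈) (out a∈) (out c∈) (pair₁ b a (inj₂ (refl , refl))) (pair₂ a c (inj₂ (refl , refl)))
    ... | no _ | no _ | yes refl | _ = through-shared a b d a≢b c≢d (λ a≡d → distinct (inj₂ (a≡d , refl)))
                                   (out a∈) (out b∈) (out d∈) (pair₁ a b (inj₁ (refl , refl))) (pair₂ b d (inj₁ (refl , refl)))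
    ... | no _ | no _ | no _ | yes refl = through-shared a b c a≢b (≢-sym c≢d) (λ a≡c → distinct (inj₁ (a≡c , refl)))
                                   (out a∈) (out b∈) (out c∈) (pair₁ a b (inj₁ (refl , refl))) (pair₂ b c (inj₂ (refl , refl)))
    ... | no a≢c | no a≢d | no b≢c | no b≢d = through-disjoint a≢c a≢d b≢c b≢d

lemma3p6 : (k : ℕ) → 6 ≤ k → {n : ℕ} (G : Graph n) (V₁ V₂ : Subset n)
    (A B : List (Fin n × Fin n))
    → EdgesOf G A → NewPairs G B
    → Setting k G V₁ V₂ A B
    → ¬ Exceptional k G V₁ V₂ A B
    → Hamiltonian (Modified G A B)
lemma3p6 k 6≤k G V₁ V₂ A B edges-A new setting not-exceptional = by-class setting
  where
  open Partitioned k 6≤k G V₁ V₂ A B new using (case-G1; case-G2)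
  open AlternatingClasses k 6≤k G V₁ V₂ A B new using (case-G4)
  by-class : Setting k G V₁ V₂ A B → Hamiltonian (Modified G A B)
  by-class (inG1 isG1 A≤2 a₁ b₁ a₂ b₂ B≡ a₁∈ b₁∈ a₂∈ b₂∈ a₁≢a₂ b₁≢b₂) =
    case-G1 isG1 A≤2 a₁ b₁ a₂ b₂ B≡ a₁∈ b₁∈ a₂∈ b₂∈ a₁≢a₂ b₁≢b₂
  by-class (inG2 x₀ isG2 A≤1 x₁ x₂ B≡ x₁∈ x₁≢x₀ x₂∈ x₂≢x₀) = case-G2 x₀ isG2 A≤1 x₁ x₂ B≡ x₁∈ x₁≢x₀ x₂∈ x₂≢x₀
  by-class (inG3 x₀ (n≡ , cover , meet , ∣V₁∣≡ , ∣V₂∣≡ , complete₁ , inside , two-connected , min-deg) A≤1 x₁ x₂ B≡ x₁∈ x₁≢x₀ x₂∈ x₂≢x₀) =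
    ClassG3.case-G3 k 6≤k G V₁ V₂ A B new x₀ n≡ cover meet ∣V₁∣≡ ∣V₂∣≡ complete₁ inside two-connected min-deg
      A≤1 x₁ x₂ B≡ x₁∈ x₁≢x₀ x₂∈ x₂≢x₀ not-exceptional
  by-class (inG4 isG4 A≤1 a b B≡ a∈ b∈) = case-G4 isG4 A≤1 a b B≡ a∈ b∈
  by-class (inG5 (n≡ , cover , disjoint , ∣V₁∣≡ , _ , one-edge , min-deg) A≤2 a b c d B≡ a∈ b∈ c∈ d∈ distinct) =
    ClassG5.case-G5 k 6≤k G V₁ V₂ A B new n≡ cover disjoint ∣V₁∣≡ one-edge min-deg edges-A A≤2 a b c d B≡ a∈ b∈ c∈ d∈ distinct
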